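{- Let $m\geq n\geq 0$, set $\mathsf{s}=\mathsf{en}$ and $\mathsf{t}=\mathsf{ne}$, and let $w$ be a word with $m$ letters $\mathsf{n}$ and $n$ letters $\mathsf{e}$. Write the expansion of $w$ in the zigzag basis of $\mathscr{P}_{m,n}$ as \[ w=\sum_{r=0}^{n}c_{w,r}\,\mathsf{s}^r\mathsf{t}^{n-r}\mathsf{n}^{m-n},\qquad c_{w,r}\in\mathbb{C}(q). \] Then each $c_{w,r}$ is a globally signed Laurent polynomial: $c_{w,r}=\varepsilon f$ for some $\varepsilon\in\{1,-1\}$ and some Laurent polynomial $f\in\mathbb{Z}_{\geq 0}[q,q^{ -1}]$ with nonnegative integer coefficients.
   Context: Let $q$ be an indeterminate. $\mathscr{P}$ denotes the noncommutative associative unital $\mathbb{C}(q)$-algebra generated by $\mathsf{n},\mathsf{e}$ subject to $(1+q)\,\mathsf{ene}=q\,\mathsf{een}+\mathsf{nee}$ and $(1+q)\,\mathsf{nen}=q\,\mathsf{enn}+\mathsf{nne}$; $\mathscr{P}_{m,n}$ is the span of the words with $m$ letters $\mathsf{n}$ and $n$ letters $\mathsf{e}$. For $m\geq n$, the zigzag monomials $\mathsf{s}^a\mathsf{t}^{n-a}\mathsf{n}^{m-n}$, $0\leq a\leq n$, form a basis of $\mathscr{P}_{m,n}$ (the zigzag basis). -}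

module Defs where

open import Data.Nat as ℕ using (ℕ; zero; suc; _∸_)
open import Data.Integer as ℤ using (ℤ; +_; -_; 0ℤ; 1ℤ)
open import Data.Bool using (Bool; true; false; _∧_; if_then_else_)
open import Data.Fin using (Fin; toℕ) renaming (zero to fz; suc to fs)
open import Data.List using (List; []; _∷_; _++_; map; foldr; replicate; concat; concatMap; tabulate)
open import Data.List.Relation.Unary.All using (All)
open import Data.Product using (_×_; _,_; ∃; proj₁)
open import Relation.Binary.PropositionalEquality using (_≡_)
open import Relation.Nullary using (¬_)

-- Polynomials in ℤ[q]: coefficient lists, constant term first.

Poly : Set
Poly = List ℤ

coeff : Poly → ℕ → ℤ
coeff []      _       = 0ℤ
coeff (a ∷ p) zero    = a
coeff (a ∷ p) (suc i) = coeff p i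

-- equality of polynomials (coefficientwise; trailing zeros irrelevant)
_≈ₚ_ : Poly → Poly → Set
p ≈ₚ r = ∀ i → coeff p i ≡ coeff r i

_+ₚ_ : Poly → Poly → Poly
[]      +ₚ r       = r
(a ∷ p) +ₚ []      = a ∷ p
(a ∷ p) +ₚ (b ∷ r) = (a ℤ.+ b) ∷ (p +ₚ r)

scaleₚ : ℤ → Poly → Poly
scaleₚ c = map (c ℤ.*_)

_*ₚ_ : Poly → Poly → Poly
[]      *ₚ r = []
(a ∷ p) *ₚ r = scaleₚ a r +ₚ (0ℤ ∷ (p *ₚ r))

qPow : ℕ → Poly
qPow zero    = 1ℤ ∷ []
qPow (suc k) = 0ℤ ∷ qPow k

-- Rational functions Q(q) = Frac(ℤ[q]) as fractions num/den.
-- Denominators are required to be nonzero where they are used (see EqP).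

record Frac : Set where
  constructor _/_
  field
    num : Poly
    den : Poly
open Frac public

NonZeroDen : Frac → Set
NonZeroDen a = ¬ (den a ≈ₚ [])

_≈F_ : Frac → Frac → Set
a ≈F b = (num a *ₚ den b) ≈ₚ (num b *ₚ den a)

_+F_ : Frac → Frac → Frac
a +F b = ((num a *ₚ den b) +ₚ (num b *ₚ den a)) / (den a *ₚ den b)

_*F_ : Frac → Frac → Frac
a *F b = (num a *ₚ num b) / (den a *ₚ den b)

negF : Frac → Frac
negF a = scaleₚ (- 1ℤ) (num a) / den a

0F 1F : Frac
0F = [] / (1ℤ ∷ [])
1F = (1ℤ ∷ []) / (1ℤ ∷ [])

data Letter : Set where
  N E : Letter

Word : Set
Word = List Letter

eqL : Letter → Letter → Bool
eqL N N = true
eqL E E = true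
eqL _ _ = false

eqW : Word → Word → Bool
eqW []      []      = true
eqW (x ∷ u) (y ∷ v) = eqL x y ∧ eqW u v
eqW _       _       = false

count : Letter → Word → ℕ
count x []      = zero
count x (y ∷ u) = if eqL x y then suc (count x u) else count x u

-- The free Q(q)-algebra on n, e: finite formal linear combinations of words.

Elem : Set
Elem = List (Frac × Word)

coefW : Word → Elem → Frac
coefW x = foldr (λ { (a , u) acc → if eqW x u then a +F acc else acc }) 0F

_−ᴱ_ : Elem → Elem → Elem
X −ᴱ Y = X ++ map (λ { (a , u) → negF a , u }) Y

scaleᴱ : Frac → Elem → Elem
scaleᴱ c = map (λ { (a , u) → c *F a , u })

-- the defining relations of 𝒫:
--  (1+q) ene − q een − nee   and   (1+q) nen − q enn − nne
onePlusQ minusQ minus1 : Frac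
onePlusQ = (1ℤ ∷ 1ℤ ∷ []) / (1ℤ ∷ [])
minusQ   = (0ℤ ∷ (- 1ℤ) ∷ []) / (1ℤ ∷ [])
minus1   = ((- 1ℤ) ∷ []) / (1ℤ ∷ [])

rel : Fin 2 → Elem
rel fz     = (onePlusQ , E ∷ N ∷ E ∷ []) ∷ (minusQ , E ∷ E ∷ N ∷ [])
                     ∷ (minus1 , N ∷ E ∷ E ∷ []) ∷ []
rel (fs _) = (onePlusQ , N ∷ E ∷ N ∷ []) ∷ (minusQ , E ∷ N ∷ N ∷ [])
                     ∷ (minus1 , N ∷ N ∷ E ∷ []) ∷ []

gen : Word → Fin 2 → Word → Elem
gen u j v = map (λ { (a , x) → a , u ++ x ++ v }) (rel j)

-- an element Σ_i a_i u_i R_{j_i} v_i of the two-sided ideal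
IdealComb : Set
IdealComb = List (Frac × Word × Fin 2 × Word)

expand : IdealComb → Elem
expand = concatMap (λ { (a , u , j , v) → scaleᴱ a (gen u j v) })

-- equality in 𝒫: X − Y lies in the two-sided ideal generated by the relations
EqP : Elem → Elem → Set
EqP X Y = ∃ λ (L : IdealComb) →
  All (λ t → NonZeroDen (proj₁ t)) L ×
  (∀ x → coefW x (X −ᴱ Y) ≈F coefW x (expand L))

sW tW : Word
sW = E ∷ N ∷ []
tW = N ∷ E ∷ []

zigzag : ℕ → ℕ → ℕ → Word
zigzag m n a = concat (replicate a sW) ++ concat (replicate (n ∸ a) tW) ++ replicate (m ∸ n) N

-- Globally signed Laurent polynomials ε · f,  ε ∈ {1,-1},
-- f = p · q^(−k) with p ∈ ℤ≥0[q]  (i.e. f ∈ ℤ≥0[q,q⁻¹]).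

data PM : Set where
  plus minus : PM

signVal : PM → ℤ
signVal plus  = 1ℤ
signVal minus = - 1ℤ

record SignedLaurent : Set where
  field
    sign   : PM
    poly   : Poly
    shift  : ℕ
    nonneg : All (λ z → 0ℤ ℤ.≤ z) poly
open SignedLaurent public

toFrac : SignedLaurent → Frac
toFrac c = scaleₚ (signVal (sign c)) (poly c) / qPow (shift c)

zigzagSum : (m n : ℕ) → (Fin (suc n) → SignedLaurent) → Elem
zigzagSum m n c = tabulate (λ r → toFrac (c r) , zigzag m n (toℕ r))

-- Write s = en and t = ne, and call #n(u) − #e(u) the height of a word u.  The two relations
-- move an adjacent pair to the front of a word: u·s·v = α_h·s·uv + β_h·t·uv, where h is the
-- height of u (plus one when the pair is t), and α, β solve α_(h+1) = −q β_h,
-- β_(h+1) = α_h + (1+q) β_h from α_0 = 1, β_0 = 0.  Their closed forms are q-integers times a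
-- power of q, with α_h and β_h of opposite signs.  By induction on #e(w), write w = u·(pair)·v,
-- expand uv in the zigzag basis with coefficients γ_r = ±(−1)^r q^(−K) F_r, F_r ≥ 0, and use
-- s·z_r = z_(r+1) and t·z_r = z_r (t commutes with s).  The new coefficients α γ_(r−1) + β γ_r
-- are again of this form: the opposite signs of α and β match the alternation of γ.

module Submission where

open import Defs
open import Algebra.Bundles using (CommutativeRing)
open import Relation.Binary.Bundles using (Setoid)
open import Data.Bool using (Bool; true; false; if_then_else_)
open import Data.Empty using (⊥-elim)
open import Data.Fin using (Fin; toℕ; fromℕ; inject₁) renaming (zero to fz; suc to fs)
open import Data.Vec.Functional using (insertAt)
open import Data.Vec.Functional.Properties using (insertAt-lookup)
open import Data.Fin.Properties using (toℕ-inject₁; toℕ≤pred[n])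
open import Data.Integer as ℤ using (ℤ; +_; +[1+_]; -[1+_]; 0ℤ; 1ℤ; -1ℤ)
import Data.Integer.Properties as ℤ
import Data.Integer.Tactic.RingSolver as ℤ-Solver
open import Data.List using (List; []; _∷_; _++_; map; replicate; concat; tabulate)
open import Data.List.Properties using (++-assoc; map-++; map-tabulate)
open import Data.List.Relation.Unary.All using (All; []; _∷_)
open import Data.Maybe using (Maybe; just; nothing)
open import Data.Nat as ℕ using (ℕ; zero; suc; _∸_; _≤_; _<_; z≤n; s≤s)
import Data.Nat.Properties as ℕ
open import Data.Product using (_×_; _,_; ∃; proj₁)
open import Data.Sum using (_⊎_; inj₁; inj₂)
open import Relation.Binary.PropositionalEquality
  using (_≡_; _≢_; refl; sym; trans; cong; cong₂; subst; subst₂; module ≡-Reasoning)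
import Relation.Binary.Reasoning.Setoid as Reasoning
open import Relation.Nullary using (¬_; yes; no)
open import Function using (case_of_)
open import Tactic.RingSolver using (solve-∀)
open import Tactic.RingSolver.Core.AlmostCommutativeRing using (AlmostCommutativeRing; fromCommutativeRing)

module Polynomial where

  -- A record rather than the bare function type p ≈ₚ r, so that p and r
  -- can be inferred from an equality proof.
  infix 4 _≈_
  record _≈_ (p r : Poly) : Set where
    constructor mk≈
    field coeff-≡ : p ≈ₚ r
  open _≈_ public

  ≈-refl : ∀ {p} → p ≈ p
  ≈-refl = mk≈ λ i → refl

  ≈-sym : ∀ {p r} → p ≈ r → r ≈ p
  ≈-sym p≈r = mk≈ λ i → sym (coeff-≡ p≈r i)

  ≈-trans : ∀ {p r s} → p ≈ r → r ≈ s → p ≈ s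
  ≈-trans p≈r r≈s = mk≈ λ i → trans (coeff-≡ p≈r i) (coeff-≡ r≈s i)

  -_ₚ : Poly → Poly
  -_ₚ = scaleₚ -1ℤ

  shifted : (ℕ → ℤ) → ℕ → ℤ
  shifted f zero    = 0ℤ
  shifted f (suc i) = f i

  coeff-+ : ∀ p r i → coeff (p +ₚ r) i ≡ coeff p i ℤ.+ coeff r i
  coeff-+ []      r       i       = sym (ℤ.+-identityˡ _)
  coeff-+ (a ∷ p) []      i       = sym (ℤ.+-identityʳ _)
  coeff-+ (a ∷ p) (b ∷ r) zero    = refl
  coeff-+ (a ∷ p) (b ∷ r) (suc i) = coeff-+ p r i

  coeff-scale : ∀ c p i → coeff (scaleₚ c p) i ≡ c ℤ.* coeff p i
  coeff-scale c []      i       = sym (ℤ.*-zeroʳ c)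
  coeff-scale c (a ∷ p) zero    = refl
  coeff-scale c (a ∷ p) (suc i) = coeff-scale c p i

  coeff-0∷ : ∀ p i → coeff (0ℤ ∷ p) i ≡ shifted (coeff p) i
  coeff-0∷ p zero    = refl
  coeff-0∷ p (suc i) = refl

  coeff-∷* : ∀ a p r i → coeff ((a ∷ p) *ₚ r) i ≡ a ℤ.* coeff r i ℤ.+ shifted (coeff (p *ₚ r)) i
  coeff-∷* a p r i = trans (coeff-+ (scaleₚ a r) _ i) (cong₂ ℤ._+_ (coeff-scale a r i) (coeff-0∷ _ i))

  shifted-cong : ∀ {f g : ℕ → ℤ} → (∀ i → f i ≡ g i) → ∀ i → shifted f i ≡ shifted g i
  shifted-cong f≗g zero    = refl
  shifted-cong f≗g (suc i) = f≗g i

  ∷-cong : ∀ {a b p r} → a ≡ b → p ≈ r → (a ∷ p) ≈ (b ∷ r)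
  ∷-cong a≡b p≈r = mk≈ λ { zero → a≡b ; (suc i) → coeff-≡ p≈r i }

  ∷-≈[] : ∀ {a p} → a ≡ 0ℤ → p ≈ [] → (a ∷ p) ≈ []
  ∷-≈[] a≡0 p≈0 = mk≈ λ { zero → a≡0 ; (suc i) → coeff-≡ p≈0 i }

  ∷-≈[]⇒≈[] : ∀ {a p} → (a ∷ p) ≈ [] → p ≈ []
  ∷-≈[]⇒≈[] a∷p≈0 = mk≈ λ i → coeff-≡ a∷p≈0 (suc i)

  ∷-injectiveʳ : ∀ {a b p r} → (a ∷ p) ≈ (b ∷ r) → p ≈ r
  ∷-injectiveʳ a∷p≈b∷r = mk≈ λ i → coeff-≡ a∷p≈b∷r (suc i)

  +-cong : ∀ {p p' r r'} → p ≈ p' → r ≈ r' → (p +ₚ r) ≈ (p' +ₚ r')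
  +-cong {p} {p'} {r} {r'} p≈p' r≈r' = mk≈ λ i →
    trans (coeff-+ p r i) (trans (cong₂ ℤ._+_ (coeff-≡ p≈p' i) (coeff-≡ r≈r' i)) (sym (coeff-+ p' r' i)))

  scale-cong : ∀ c {p r} → p ≈ r → scaleₚ c p ≈ scaleₚ c r
  scale-cong c {p} {r} p≈r = mk≈ λ i →
    trans (coeff-scale c p i) (trans (cong (c ℤ.*_) (coeff-≡ p≈r i)) (sym (coeff-scale c r i)))

  +-assoc : ∀ p r s → ((p +ₚ r) +ₚ s) ≈ (p +ₚ (r +ₚ s))
  +-assoc p r s = mk≈ λ i → trans (coeff-+ (p +ₚ r) s i) (trans (cong (ℤ._+ coeff s i) (coeff-+ p r i))
    (trans (ℤ.+-assoc (coeff p i) (coeff r i) (coeff s i))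
    (trans (cong (λ z → coeff p i ℤ.+ z) (sym (coeff-+ r s i))) (sym (coeff-+ p (r +ₚ s) i)))))

  +-comm : ∀ p r → (p +ₚ r) ≈ (r +ₚ p)
  +-comm p r = mk≈ λ i → trans (coeff-+ p r i) (trans (ℤ.+-comm (coeff p i) (coeff r i)) (sym (coeff-+ r p i)))

  +-identityʳ : ∀ p → (p +ₚ []) ≈ p
  +-identityʳ p = mk≈ λ i → trans (coeff-+ p [] i) (ℤ.+-identityʳ _)

  +-inverseˡ : ∀ p → (-_ₚ p +ₚ p) ≈ []
  +-inverseˡ p = mk≈ λ i → trans (coeff-+ (-_ₚ p) p i)
    (trans (cong (ℤ._+ coeff p i) (coeff-scale -1ℤ p i)) (-1*x+x≡0 (coeff p i)))
    where -1*x+x≡0 : ∀ x → -1ℤ ℤ.* x ℤ.+ x ≡ 0ℤ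
          -1*x+x≡0 = ℤ-Solver.solve-∀

  scale-zero : ∀ p → scaleₚ 0ℤ p ≈ []
  scale-zero p = mk≈ (coeff-scale 0ℤ p)

  *-zeroˡ-≈ : ∀ p r → p ≈ [] → (p *ₚ r) ≈ []
  *-zeroˡ-≈ []      r p≈0 = ≈-refl
  *-zeroˡ-≈ (a ∷ p) r a∷p≈0 = mk≈ λ i → trans (coeff-∷* a p r i)
    (trans (cong₂ ℤ._+_ (cong (ℤ._* coeff r i) (coeff-≡ a∷p≈0 zero))
                        (shifted-cong (coeff-≡ (*-zeroˡ-≈ p r (∷-≈[]⇒≈[] a∷p≈0))) i))
    (shifted-zero i))
    where shifted-zero : ∀ i → 0ℤ ℤ.* coeff r i ℤ.+ shifted (coeff []) i ≡ 0ℤ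
          shifted-zero zero    = refl
          shifted-zero (suc i) = refl

  *-congʳ : ∀ {p p'} r → p ≈ p' → (p *ₚ r) ≈ (p' *ₚ r)
  *-congʳ {[]}    {p'}     r p≈p' = ≈-sym (*-zeroˡ-≈ p' r (≈-sym p≈p'))
  *-congʳ {a ∷ p} {[]}     r p≈p' = *-zeroˡ-≈ (a ∷ p) r p≈p'
  *-congʳ {a ∷ p} {b ∷ p'} r p≈p' = mk≈ λ i → trans (coeff-∷* a p r i)
    (trans (cong₂ ℤ._+_ (cong (ℤ._* coeff r i) (coeff-≡ p≈p' zero))
                        (shifted-cong (coeff-≡ (*-congʳ r (∷-injectiveʳ p≈p'))) i))
    (sym (coeff-∷* b p' r i)))

  *-congˡ : ∀ p {r r'} → r ≈ r' → (p *ₚ r) ≈ (p *ₚ r')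
  *-congˡ []      r≈r' = ≈-refl
  *-congˡ (a ∷ p) {r} {r'} r≈r' = mk≈ λ i → trans (coeff-∷* a p r i)
    (trans (cong₂ ℤ._+_ (cong (a ℤ.*_) (coeff-≡ r≈r' i)) (shifted-cong (coeff-≡ (*-congˡ p r≈r')) i))
    (sym (coeff-∷* a p r' i)))

  *-cong : ∀ {p p' r r'} → p ≈ p' → r ≈ r' → (p *ₚ r) ≈ (p' *ₚ r')
  *-cong {p} {p'} {r} p≈p' r≈r' = ≈-trans (*-congʳ r p≈p') (*-congˡ p' r≈r')

  *-distribʳ : ∀ r p p' → ((p +ₚ p') *ₚ r) ≈ ((p *ₚ r) +ₚ (p' *ₚ r))
  *-distribʳ r []      p'       = ≈-refl
  *-distribʳ r (a ∷ p) []       = ≈-sym (+-identityʳ _)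
  *-distribʳ r (a ∷ p) (b ∷ p') = mk≈ λ i →
    trans (coeff-∷* (a ℤ.+ b) (p +ₚ p') r i)
    (trans (cong (λ z → (a ℤ.+ b) ℤ.* coeff r i ℤ.+ z)
                 (shifted-cong (λ j → trans (coeff-≡ (*-distribʳ r p p') j) (coeff-+ (p *ₚ r) (p' *ₚ r) j)) i))
    (trans (regroup i)
    (sym (trans (coeff-+ ((a ∷ p) *ₚ r) ((b ∷ p') *ₚ r) i) (cong₂ ℤ._+_ (coeff-∷* a p r i) (coeff-∷* b p' r i))))))
    where
    distrib : ∀ a b c x y → (a ℤ.+ b) ℤ.* c ℤ.+ (x ℤ.+ y) ≡ (a ℤ.* c ℤ.+ x) ℤ.+ (b ℤ.* c ℤ.+ y)
    distrib = ℤ-Solver.solve-∀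
    regroup : ∀ i → (a ℤ.+ b) ℤ.* coeff r i ℤ.+ shifted (λ j → coeff (p *ₚ r) j ℤ.+ coeff (p' *ₚ r) j) i
                  ≡ (a ℤ.* coeff r i ℤ.+ shifted (coeff (p *ₚ r)) i) ℤ.+ (b ℤ.* coeff r i ℤ.+ shifted (coeff (p' *ₚ r)) i)
    regroup zero    = distrib a b (coeff r 0) 0ℤ 0ℤ
    regroup (suc i) = distrib a b (coeff r (suc i)) _ _

  *-zeroʳ : ∀ p → (p *ₚ []) ≈ []
  *-zeroʳ []      = ≈-refl
  *-zeroʳ (a ∷ p) = ∷-≈[] refl (*-zeroʳ p)

  *-∷ʳ : ∀ p b r → (p *ₚ (b ∷ r)) ≈ (scaleₚ b p +ₚ (0ℤ ∷ (p *ₚ r)))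
  *-∷ʳ []      b r = ≈-sym (∷-≈[] refl ≈-refl)
  *-∷ʳ (a ∷ p) b r = mk≈ λ
    { zero    → swap a b
    ; (suc i) → trans (coeff-+ (scaleₚ a r) (p *ₚ (b ∷ r)) i)
        (trans (cong (λ z → coeff (scaleₚ a r) i ℤ.+ z) (trans (coeff-≡ (*-∷ʳ p b r) i) (coeff-+ (scaleₚ b p) _ i)))
        (trans (exchange (coeff (scaleₚ a r) i) (coeff (scaleₚ b p) i) (coeff (0ℤ ∷ (p *ₚ r)) i))
        (sym (trans (coeff-+ (scaleₚ b p) _ i) (cong (λ z → coeff (scaleₚ b p) i ℤ.+ z) (coeff-+ (scaleₚ a r) _ i)))))) }
    where
    swap : ∀ a b → a ℤ.* b ℤ.+ 0ℤ ≡ b ℤ.* a ℤ.+ 0ℤ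
    swap = ℤ-Solver.solve-∀
    exchange : ∀ x y z → x ℤ.+ (y ℤ.+ z) ≡ y ℤ.+ (x ℤ.+ z)
    exchange = ℤ-Solver.solve-∀

  *-comm : ∀ p r → (p *ₚ r) ≈ (r *ₚ p)
  *-comm []      r = ≈-sym (*-zeroʳ r)
  *-comm (a ∷ p) r = ≈-trans (+-cong (≈-refl {scaleₚ a r}) (∷-cong refl (*-comm p r))) (≈-sym (*-∷ʳ r a p))

  scale-* : ∀ c p r → (scaleₚ c p *ₚ r) ≈ scaleₚ c (p *ₚ r)
  scale-* c []      r = ≈-refl
  scale-* c (a ∷ p) r = mk≈ λ i →
    trans (coeff-∷* (c ℤ.* a) (scaleₚ c p) r i)
    (trans (cong (λ z → (c ℤ.* a) ℤ.* coeff r i ℤ.+ z)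
                 (shifted-cong (λ j → trans (coeff-≡ (scale-* c p r) j) (coeff-scale c (p *ₚ r) j)) i))
    (trans (pull i) (sym (trans (coeff-scale c ((a ∷ p) *ₚ r) i) (cong (c ℤ.*_) (coeff-∷* a p r i))))))
    where
    factor : ∀ c a x y → (c ℤ.* a) ℤ.* x ℤ.+ c ℤ.* y ≡ c ℤ.* (a ℤ.* x ℤ.+ y)
    factor = ℤ-Solver.solve-∀
    pull : ∀ i → (c ℤ.* a) ℤ.* coeff r i ℤ.+ shifted (λ j → c ℤ.* coeff (p *ₚ r) j) i
               ≡ c ℤ.* (a ℤ.* coeff r i ℤ.+ shifted (coeff (p *ₚ r)) i)
    pull zero    = trans (cong (λ z → (c ℤ.* a) ℤ.* coeff r 0 ℤ.+ z) (sym (ℤ.*-zeroʳ c))) (factor c a _ 0ℤ)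
    pull (suc i) = factor c a _ _

  0∷-* : ∀ p r → ((0ℤ ∷ p) *ₚ r) ≈ (0ℤ ∷ (p *ₚ r))
  0∷-* p r = +-cong (scale-zero r) ≈-refl

  *-assoc : ∀ p r s → ((p *ₚ r) *ₚ s) ≈ (p *ₚ (r *ₚ s))
  *-assoc []      r s = ≈-refl
  *-assoc (a ∷ p) r s = ≈-trans (*-distribʳ s (scaleₚ a r) (0ℤ ∷ (p *ₚ r)))
    (+-cong (scale-* a r s) (≈-trans (0∷-* (p *ₚ r) s) (∷-cong refl (*-assoc p r s))))

  1ₚ : Poly
  1ₚ = 1ℤ ∷ []

  *-identityˡ : ∀ p → (1ₚ *ₚ p) ≈ p
  *-identityˡ p = mk≈ λ i → trans (coeff-∷* 1ℤ [] p i) (unit i)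
    where unit : ∀ i → 1ℤ ℤ.* coeff p i ℤ.+ shifted (coeff []) i ≡ coeff p i
          unit zero    = trans (ℤ.+-identityʳ _) (ℤ.*-identityˡ _)
          unit (suc i) = trans (ℤ.+-identityʳ _) (ℤ.*-identityˡ _)

  q*ₚ : ∀ p → ((0ℤ ∷ 1ℤ ∷ []) *ₚ p) ≈ (0ℤ ∷ p)
  q*ₚ p = ≈-trans (0∷-* 1ₚ p) (∷-cong refl (*-identityˡ p))

  commutativeRing : CommutativeRing _ _
  commutativeRing = record
    { Carrier = Poly ; _≈_ = _≈_ ; _+_ = _+ₚ_ ; _*_ = _*ₚ_ ; -_ = -_ₚ ; 0# = [] ; 1# = 1ₚ
    ; isCommutativeRing = record
      { isRing = record
        { +-isAbelianGroup = record
          { isGroup = record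
            { isMonoid = record
              { isSemigroup = record
                { isMagma = record
                  { isEquivalence = record { refl = ≈-refl ; sym = ≈-sym ; trans = ≈-trans }
                  ; ∙-cong = +-cong }
                ; assoc = +-assoc }
              ; identity = (λ p → ≈-refl) , +-identityʳ }
            ; inverse = +-inverseˡ , (λ p → ≈-trans (+-comm p (-_ₚ p)) (+-inverseˡ p))
            ; ⁻¹-cong = scale-cong -1ℤ }
          ; comm = +-comm }
        ; *-cong = *-cong
        ; *-assoc = *-assoc
        ; *-identity = *-identityˡ , (λ p → ≈-trans (*-comm p 1ₚ) (*-identityˡ p))
        ; distrib = (λ p r s → ≈-trans (*-comm p (r +ₚ s))
                                 (≈-trans (*-distribʳ p r s) (+-cong (*-comm r p) (*-comm s p))))
                  , *-distribʳ }
      ; *-comm = *-comm } }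

  module ≈-Reasoning = Reasoning (CommutativeRing.setoid commutativeRing)

  []≈? : ∀ p → Maybe ([] ≈ p)
  []≈? []      = just ≈-refl
  []≈? (a ∷ p) with a ℤ.≟ 0ℤ | []≈? p
  ... | yes a≡0 | just []≈p = just (≈-sym (∷-≈[] a≡0 (≈-sym []≈p)))
  ... | _       | _         = nothing

  almostCommutativeRing : AlmostCommutativeRing _ _
  almostCommutativeRing = fromCommutativeRing commutativeRing []≈?

  const≢0-*≈[]⇒≈[] : ∀ a p d → a ≢ 0ℤ → ((a ∷ p) *ₚ d) ≈ [] → d ≈ []
  const≢0-*≈[]⇒≈[] a p []      a≢0 _    = ≈-refl
  const≢0-*≈[]⇒≈[] a p (b ∷ d) a≢0 prod≈0 = ∷-≈[] b≡0 (const≢0-*≈[]⇒≈[] a p d a≢0 (∷-≈[]⇒≈[] shifted≈0))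
    where
    b≡0 : b ≡ 0ℤ
    b≡0 with ℤ.i*j≡0⇒i≡0∨j≡0 a (trans (sym (ℤ.+-identityʳ _)) (coeff-≡ prod≈0 zero))
    ... | inj₁ a≡0 = ⊥-elim (a≢0 a≡0)
    ... | inj₂ b≡0 = b≡0
    shifted≈0 : (0ℤ ∷ ((a ∷ p) *ₚ d)) ≈ []
    shifted≈0 = begin
      [] +ₚ (0ℤ ∷ ((a ∷ p) *ₚ d))              ≈⟨ +-cong (≈-sym scale-b≈0) ≈-refl ⟩
      scaleₚ b (a ∷ p) +ₚ (0ℤ ∷ ((a ∷ p) *ₚ d)) ≈⟨ ≈-sym (*-∷ʳ (a ∷ p) b d) ⟩
      (a ∷ p) *ₚ (b ∷ d)                        ≈⟨ prod≈0 ⟩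
      []                                        ∎
      where
      open ≈-Reasoning
      scale-b≈0 : scaleₚ b (a ∷ p) ≈ []
      scale-b≈0 = subst (λ c → scaleₚ c (a ∷ p) ≈ []) (sym b≡0) (scale-zero (a ∷ p))

  *-≈[]⇒≈[] : ∀ p d → (p *ₚ d) ≈ [] → ¬ d ≈ [] → p ≈ []
  *-≈[]⇒≈[] []      d _ _ = ≈-refl
  *-≈[]⇒≈[] (a ∷ p) d prod≈0 d≉0 with a ℤ.≟ 0ℤ
  ... | yes refl = ∷-≈[] refl (*-≈[]⇒≈[] p d (∷-≈[]⇒≈[] (≈-trans (≈-sym (0∷-* p d)) prod≈0)) d≉0)
  ... | no a≢0   = ⊥-elim (d≉0 (const≢0-*≈[]⇒≈[] a p d a≢0 prod≈0))

  *-≉[] : ∀ {d e} → ¬ d ≈ [] → ¬ e ≈ [] → ¬ (d *ₚ e) ≈ []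
  *-≉[] {d} {e} d≉0 e≉0 de≈0 = d≉0 (*-≈[]⇒≈[] d e de≈0 e≉0)

  *-cancelʳ : ∀ p r d → ¬ d ≈ [] → (p *ₚ d) ≈ (r *ₚ d) → p ≈ r
  *-cancelʳ p r d d≉0 pd≈rd = begin
    p                  ≈⟨ p≈p-r+r p r ⟩
    (p +ₚ -_ₚ r) +ₚ r  ≈⟨ +-cong (*-≈[]⇒≈[] (p +ₚ -_ₚ r) d difference≈0 d≉0) ≈-refl ⟩
    r                  ∎
    where
    open ≈-Reasoning
    p≈p-r+r : ∀ p r → p ≈ (p +ₚ -_ₚ r) +ₚ r
    p≈p-r+r = solve-∀ almostCommutativeRing
    distrib : ∀ p r d → ((p +ₚ -_ₚ r) *ₚ d) ≈ ((p *ₚ d) +ₚ -_ₚ (r *ₚ d))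
    distrib = solve-∀ almostCommutativeRing
    x-x≈0 : ∀ x → (x +ₚ -_ₚ x) ≈ []
    x-x≈0 = solve-∀ almostCommutativeRing
    difference≈0 : ((p +ₚ -_ₚ r) *ₚ d) ≈ []
    difference≈0 = begin
      (p +ₚ -_ₚ r) *ₚ d         ≈⟨ distrib p r d ⟩
      (p *ₚ d) +ₚ -_ₚ (r *ₚ d)  ≈⟨ +-cong pd≈rd ≈-refl ⟩
      (r *ₚ d) +ₚ -_ₚ (r *ₚ d)  ≈⟨ x-x≈0 (r *ₚ d) ⟩
      []                        ∎

module RationalFunctions where

  open Polynomial using (_≈_; mk≈; coeff-≡; ≈-refl; ≈-sym; ≈-trans; 1ₚ; -_ₚ; *-≉[]; *-cancelʳ; []≈?)
  private module P = Polynomial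

  -- Without η the operations below, defined by matching on mk, stay stuck on variables, so
  -- that ring expressions keep their shape for unification and for the ring solver.
  record RatFun : Set where
    no-eta-equality
    pattern
    constructor mk
    field
      frac  : Frac
      den≉0 : ¬ den frac ≈ []
  open RatFun public

  infix 4 _≃_
  record _≃_ (x y : RatFun) : Set where
    constructor mk≃
    field cross : (num (frac x) *ₚ den (frac y)) ≈ (num (frac y) *ₚ den (frac x))
  open _≃_ public

  1ₚ≉[] : ¬ 1ₚ ≈ []
  1ₚ≉[] 1ₚ≈[] with coeff-≡ 1ₚ≈[] 0
  ... | ()

  infixl 6 _+_
  infixl 7 _*_
  infix  8 -_

  _+_ : RatFun → RatFun → RatFun
  mk a a≉0 + mk b b≉0 = mk (a +F b) (*-≉[] a≉0 b≉0)

  _*_ : RatFun → RatFun → RatFun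
  mk a a≉0 * mk b b≉0 = mk (a *F b) (*-≉[] a≉0 b≉0)

  -_ : RatFun → RatFun
  - mk a a≉0 = mk (negF a) a≉0

  ⟦_⟧ : Poly → RatFun
  ⟦ p ⟧ = mk (p / 1ₚ) 1ₚ≉[]

  frac-+ : ∀ x y → frac (x + y) ≡ frac x +F frac y
  frac-+ (mk _ _) (mk _ _) = refl

  frac-- : ∀ x → frac (- x) ≡ negF (frac x)
  frac-- (mk _ _) = refl

  0# 1# : RatFun
  0# = mk 0F 1ₚ≉[]
  1# = mk 1F 1ₚ≉[]

  ≃-refl : ∀ {x} → x ≃ x
  ≃-refl = mk≃ ≈-refl

  ≃-reflexive : ∀ {x y} → x ≡ y → x ≃ y
  ≃-reflexive refl = ≃-refl

  ≃-sym : ∀ {x y} → x ≃ y → y ≃ x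
  ≃-sym (mk≃ x≃y) = mk≃ (≈-sym x≃y)

  -- Transitivity of cross-multiplication is where ℤ[q] having no zero divisors is needed.
  ≃-trans : ∀ {x y z} → x ≃ y → y ≃ z → x ≃ z
  ≃-trans {mk (na / da) _} {mk (nb / db) db≉0} {mk (nc / dc) _} (mk≃ x≃y) (mk≃ y≃z) =
    mk≃ (*-cancelʳ (na *ₚ dc) (nc *ₚ da) db db≉0 (begin
      (na *ₚ dc) *ₚ db  ≈⟨ swap23 na dc db ⟩
      (na *ₚ db) *ₚ dc  ≈⟨ P.*-cong x≃y ≈-refl ⟩
      (nb *ₚ da) *ₚ dc  ≈⟨ swap23 nb da dc ⟩
      (nb *ₚ dc) *ₚ da  ≈⟨ P.*-cong y≃z ≈-refl ⟩
      (nc *ₚ db) *ₚ da  ≈⟨ swap23 nc db da ⟩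
      (nc *ₚ da) *ₚ db  ∎))
    where
    open P.≈-Reasoning
    swap23 : ∀ a b c → ((a *ₚ b) *ₚ c) ≈ ((a *ₚ c) *ₚ b)
    swap23 = solve-∀ P.almostCommutativeRing

  +-cong : ∀ {x x' y y'} → x ≃ x' → y ≃ y' → x + y ≃ x' + y'
  +-cong {mk (na / da) _} {mk (na' / da') _} {mk (nb / db) _} {mk (nb' / db') _} (mk≃ x≃x') (mk≃ y≃y') =
    mk≃ (≈-trans (distribute na db nb da da' db')
        (≈-trans (P.+-cong (P.*-cong x≃x' ≈-refl) (P.*-cong y≃y' ≈-refl))
                 (≈-sym (distribute' na' db' nb' da' da db))))
    where
    distribute : ∀ a b c d e f →
      (((a *ₚ b) +ₚ (c *ₚ d)) *ₚ (e *ₚ f)) ≈ (((a *ₚ e) *ₚ (b *ₚ f)) +ₚ ((c *ₚ f) *ₚ (d *ₚ e)))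
    distribute = solve-∀ P.almostCommutativeRing
    distribute' : ∀ a b c d e f →
      (((a *ₚ b) +ₚ (c *ₚ d)) *ₚ (e *ₚ f)) ≈ (((a *ₚ e) *ₚ (f *ₚ b)) +ₚ ((c *ₚ f) *ₚ (e *ₚ d)))
    distribute' = solve-∀ P.almostCommutativeRing

  *-cong : ∀ {x x' y y'} → x ≃ x' → y ≃ y' → x * y ≃ x' * y'
  *-cong {mk (na / da) _} {mk (na' / da') _} {mk (nb / db) _} {mk (nb' / db') _} (mk≃ x≃x') (mk≃ y≃y') =
    mk≃ (≈-trans (regroup na nb da' db') (≈-trans (P.*-cong x≃x' y≃y') (regroup na' da nb' db)))
    where
    regroup : ∀ a b c d → ((a *ₚ b) *ₚ (c *ₚ d)) ≈ ((a *ₚ c) *ₚ (b *ₚ d))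
    regroup = solve-∀ P.almostCommutativeRing

  -‿cong : ∀ {x x'} → x ≃ x' → - x ≃ - x'
  -‿cong {mk (na / da) _} {mk (na' / da') _} (mk≃ x≃x') =
    mk≃ (≈-trans (P.scale-* -1ℤ na da') (≈-trans (P.scale-cong -1ℤ x≃x') (≈-sym (P.scale-* -1ℤ na' da))))

  +-assoc : ∀ x y z → (x + y) + z ≃ x + (y + z)
  +-assoc (mk (na / da) _) (mk (nb / db) _) (mk (nc / dc) _) = mk≃ (law na da nb db nc dc)
    where
    law : ∀ na da nb db nc dc →
      ((((na *ₚ db) +ₚ (nb *ₚ da)) *ₚ dc) +ₚ (nc *ₚ (da *ₚ db))) *ₚ (da *ₚ (db *ₚ dc))
        ≈ ((na *ₚ (db *ₚ dc)) +ₚ (((nb *ₚ dc) +ₚ (nc *ₚ db)) *ₚ da)) *ₚ ((da *ₚ db) *ₚ dc)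
    law = solve-∀ P.almostCommutativeRing

  +-comm : ∀ x y → x + y ≃ y + x
  +-comm (mk (na / da) _) (mk (nb / db) _) = mk≃ (law na da nb db)
    where
    law : ∀ na da nb db →
      (((na *ₚ db) +ₚ (nb *ₚ da)) *ₚ (db *ₚ da)) ≈ (((nb *ₚ da) +ₚ (na *ₚ db)) *ₚ (da *ₚ db))
    law = solve-∀ P.almostCommutativeRing

  +-identityˡ : ∀ x → 0# + x ≃ x
  +-identityˡ (mk (na / da) _) = mk≃ (law na da)
    where
    law : ∀ na da → ((([] *ₚ da) +ₚ (na *ₚ 1ₚ)) *ₚ da) ≈ (na *ₚ (1ₚ *ₚ da))
    law = solve-∀ P.almostCommutativeRing

  +-inverseˡ : ∀ x → (- x) + x ≃ 0#
  +-inverseˡ (mk (na / da) _) = mk≃ (law na da)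
    where
    law : ∀ na da → ((((-_ₚ na) *ₚ da) +ₚ (na *ₚ da)) *ₚ 1ₚ) ≈ ([] *ₚ (da *ₚ da))
    law = solve-∀ P.almostCommutativeRing

  *-assoc : ∀ x y z → (x * y) * z ≃ x * (y * z)
  *-assoc (mk (na / da) _) (mk (nb / db) _) (mk (nc / dc) _) = mk≃ (law na da nb db nc dc)
    where
    law : ∀ na da nb db nc dc →
      (((na *ₚ nb) *ₚ nc) *ₚ (da *ₚ (db *ₚ dc))) ≈ ((na *ₚ (nb *ₚ nc)) *ₚ ((da *ₚ db) *ₚ dc))
    law = solve-∀ P.almostCommutativeRing

  *-comm : ∀ x y → x * y ≃ y * x
  *-comm (mk (na / da) _) (mk (nb / db) _) = mk≃ (law na da nb db)
    where
    law : ∀ na da nb db → ((na *ₚ nb) *ₚ (db *ₚ da)) ≈ ((nb *ₚ na) *ₚ (da *ₚ db))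
    law = solve-∀ P.almostCommutativeRing

  *-identityˡ : ∀ x → 1# * x ≃ x
  *-identityˡ (mk (na / da) _) = mk≃ (law na da)
    where
    law : ∀ na da → ((1ₚ *ₚ na) *ₚ da) ≈ (na *ₚ (1ₚ *ₚ da))
    law = solve-∀ P.almostCommutativeRing

  *-distribʳ : ∀ z x y → (x + y) * z ≃ (x * z) + (y * z)
  *-distribʳ (mk (nc / dc) _) (mk (na / da) _) (mk (nb / db) _) = mk≃ (law na da nb db nc dc)
    where
    law : ∀ na da nb db nc dc →
      ((((na *ₚ db) +ₚ (nb *ₚ da)) *ₚ nc) *ₚ ((da *ₚ dc) *ₚ (db *ₚ dc)))
        ≈ ((((na *ₚ nc) *ₚ (db *ₚ dc)) +ₚ ((nb *ₚ nc) *ₚ (da *ₚ dc))) *ₚ ((da *ₚ db) *ₚ dc))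
    law = solve-∀ P.almostCommutativeRing

  commutativeRing : CommutativeRing _ _
  commutativeRing = record
    { Carrier = RatFun ; _≈_ = _≃_ ; _+_ = _+_ ; _*_ = _*_ ; -_ = -_ ; 0# = 0# ; 1# = 1#
    ; isCommutativeRing = record
      { isRing = record
        { +-isAbelianGroup = record
          { isGroup = record
            { isMonoid = record
              { isSemigroup = record
                { isMagma = record
                  { isEquivalence = record { refl = ≃-refl ; sym = ≃-sym ; trans = ≃-trans }
                  ; ∙-cong = +-cong }
                ; assoc = +-assoc }
              ; identity = +-identityˡ , λ x → ≃-trans (+-comm x 0#) (+-identityˡ x) }
            ; inverse = +-inverseˡ , λ x → ≃-trans (+-comm x (- x)) (+-inverseˡ x)
            ; ⁻¹-cong = -‿cong }
          ; comm = +-comm }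
        ; *-cong = *-cong
        ; *-assoc = *-assoc
        ; *-identity = *-identityˡ , λ x → ≃-trans (*-comm x 1#) (*-identityˡ x)
        ; distrib = (λ z x y → ≃-trans (*-comm z (x + y)) (≃-trans (*-distribʳ z x y)
                                 (+-cong (*-comm x z) (*-comm y z))))
                  , *-distribʳ }
      ; *-comm = *-comm } }

  0≃? : ∀ x → Maybe (0# ≃ x)
  0≃? x with []≈? (num (frac x) *ₚ 1ₚ)
  ... | just 0≈x = just (mk≃ 0≈x)
  ... | nothing  = nothing

  almostCommutativeRing : AlmostCommutativeRing _ _
  almostCommutativeRing = fromCommutativeRing commutativeRing 0≃?

  module ≃-Reasoning = Reasoning (CommutativeRing.setoid commutativeRing)

  ≃-modulo : ∀ {x y c a b} → a ≃ b → x ≃ y + c * (a + - b) → x ≃ y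
  ≃-modulo {x} {y} {c} {a} {b} a≃b x≃y+c[a-b] =
    ≃-trans x≃y+c[a-b] (≃-trans (+-cong ≃-refl (*-cong ≃-refl (+-cong a≃b ≃-refl))) (vanish y c b))
    where vanish : ∀ y c b → y + c * (b + - b) ≃ y
          vanish = solve-∀ almostCommutativeRing

  ⟦⟧-+ : ∀ p r → ⟦ p +ₚ r ⟧ ≃ ⟦ p ⟧ + ⟦ r ⟧
  ⟦⟧-+ p r = mk≃ (law p r)
    where law : ∀ p r → ((p +ₚ r) *ₚ (1ₚ *ₚ 1ₚ)) ≈ (((p *ₚ 1ₚ) +ₚ (r *ₚ 1ₚ)) *ₚ 1ₚ)
          law = solve-∀ P.almostCommutativeRing

  ⟦⟧-* : ∀ p r → ⟦ p *ₚ r ⟧ ≃ ⟦ p ⟧ * ⟦ r ⟧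
  ⟦⟧-* p r = mk≃ (law p r)
    where law : ∀ p r → ((p *ₚ r) *ₚ (1ₚ *ₚ 1ₚ)) ≈ ((p *ₚ r) *ₚ 1ₚ)
          law = solve-∀ P.almostCommutativeRing

  ⟦⟧-cong : ∀ {p r} → p ≈ r → ⟦ p ⟧ ≃ ⟦ r ⟧
  ⟦⟧-cong p≈r = mk≃ (P.*-cong p≈r ≈-refl)

  -- Kept abstract so that expressions in q stay stuck and unification can see their shape.
  abstract
    q : RatFun
    q = ⟦ 0ℤ ∷ 1ℤ ∷ [] ⟧

    q⁻¹ : RatFun
    q⁻¹ = mk (1ₚ / (0ℤ ∷ 1ℤ ∷ [])) λ q≈[] → case coeff-≡ q≈[] 1 of λ ()

    q*q⁻¹≃1 : q * q⁻¹ ≃ 1#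
    q*q⁻¹≃1 = mk≃ (mk≈ λ { 0 → refl ; 1 → refl ; (suc (suc i)) → refl })

    q⁻¹*1/d≃1/qd : ∀ {d d≉0 0∷d≉0} → q⁻¹ * mk (1ₚ / d) d≉0 ≃ mk (1ₚ / (0ℤ ∷ d)) 0∷d≉0
    q⁻¹*1/d≃1/qd {d} = mk≃ (≈-trans (law (0ℤ ∷ d)) (P.*-congˡ 1ₚ (≈-sym (P.q*ₚ d))))
      where law : ∀ x → ((1ₚ *ₚ 1ₚ) *ₚ x) ≈ (1ₚ *ₚ x)
            law = solve-∀ P.almostCommutativeRing

    ⟦∷⟧ : ∀ a p → ⟦ a ∷ p ⟧ ≃ ⟦ a ∷ [] ⟧ + q * ⟦ p ⟧
    ⟦∷⟧ a p = begin
      ⟦ a ∷ p ⟧                      ≈⟨ ⟦⟧-cong split ⟩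
      ⟦ (a ∷ []) +ₚ (0ℤ ∷ p) ⟧       ≈⟨ ⟦⟧-+ (a ∷ []) (0ℤ ∷ p) ⟩
      ⟦ a ∷ [] ⟧ + ⟦ 0ℤ ∷ p ⟧        ≈⟨ +-cong {⟦ a ∷ [] ⟧} ≃-refl (⟦⟧-cong (≈-sym (P.q*ₚ p))) ⟩
      ⟦ a ∷ [] ⟧ + ⟦ (0ℤ ∷ 1ℤ ∷ []) *ₚ p ⟧ ≈⟨ +-cong {⟦ a ∷ [] ⟧} ≃-refl (⟦⟧-* (0ℤ ∷ 1ℤ ∷ []) p) ⟩
      ⟦ a ∷ [] ⟧ + q * ⟦ p ⟧         ∎
      where
      split : (a ∷ p) ≈ ((a ∷ []) +ₚ (0ℤ ∷ p))
      split = P.∷-cong (sym (ℤ.+-identityʳ a)) ≈-refl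
      open ≃-Reasoning

  q⁻¹^ : ℕ → RatFun
  q⁻¹^ zero    = 1#
  q⁻¹^ (suc k) = q⁻¹ * q⁻¹^ k

-- Linear combinations of words, and congruence modulo the relations

module LinearCombinations where

  open Polynomial using (mk≈; coeff-≡)
  open RationalFunctions
  open ≃-Reasoning

  Combination : Set
  Combination = List (RatFun × Word)

  ⌊_⌋ : Combination → Elem
  ⌊_⌋ = map λ { (a , u) → frac a , u }

  coefficient : Word → Combination → RatFun
  coefficient x []            = 0#
  coefficient x ((a , u) ∷ X) = if eqW x u then a + coefficient x X else coefficient x X

  coefW-⌊⌋ : ∀ x X → coefW x ⌊ X ⌋ ≡ frac (coefficient x X)
  coefW-⌊⌋ x []            = refl
  coefW-⌊⌋ x ((a , u) ∷ X) with eqW x u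
  ... | true  = trans (cong (frac a +F_) (coefW-⌊⌋ x X)) (sym (frac-+ a (coefficient x X)))
  ... | false = coefW-⌊⌋ x X

  [_] : Bool → RatFun
  [ true  ] = 1#
  [ false ] = 0#

  coefficient-∷ : ∀ x a u X → coefficient x ((a , u) ∷ X) ≃ [ eqW x u ] * a + coefficient x X
  coefficient-∷ x a u X with eqW x u
  ... | true  = +-cong (≃-sym (*-identityˡ a)) ≃-refl
  ... | false = ≃-sym (lemma a (coefficient x X))
    where lemma : ∀ a c → 0# * a + c ≃ c
          lemma = solve-∀ almostCommutativeRing

  coefficient-++ : ∀ x X Y → coefficient x (X ++ Y) ≃ coefficient x X + coefficient x Y
  coefficient-++ x []            Y = ≃-sym (+-identityˡ _)
  coefficient-++ x ((a , u) ∷ X) Y with eqW x u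
  ... | true  = ≃-trans (+-cong ≃-refl (coefficient-++ x X Y)) (≃-sym (+-assoc a _ _))
  ... | false = coefficient-++ x X Y

  scale : RatFun → Combination → Combination
  scale c = map λ { (a , u) → c * a , u }

  coefficient-scale : ∀ x c X → coefficient x (scale c X) ≃ c * coefficient x X
  coefficient-scale x c []            = ≃-sym (x*0≃0 c)
    where x*0≃0 : ∀ x → x * 0# ≃ 0#
          x*0≃0 = solve-∀ almostCommutativeRing
  coefficient-scale x c ((a , u) ∷ X) with eqW x u
  ... | true  = ≃-trans (+-cong ≃-refl (coefficient-scale x c X)) (≃-sym (distribˡ c a _))
    where distribˡ : ∀ x y z → x * (y + z) ≃ x * y + x * z
          distribˡ = solve-∀ almostCommutativeRing
  ... | false = coefficient-scale x c X

  negate : Combination → Combination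
  negate = map λ { (a , u) → - a , u }

  coefficient-negate : ∀ x X → coefficient x (negate X) ≃ - coefficient x X
  coefficient-negate x []            = ≃-sym (-0≃0)
    where -0≃0 : - 0# ≃ 0#
          -0≃0 = solve-∀ almostCommutativeRing
  coefficient-negate x ((a , u) ∷ X) with eqW x u
  ... | true  = ≃-trans (+-cong ≃-refl (coefficient-negate x X)) (≃-sym (-‿distrib a _))
    where -‿distrib : ∀ x y → - (x + y) ≃ - x + - y
          -‿distrib = solve-∀ almostCommutativeRing
  ... | false = coefficient-negate x X

  relation : Fin 2 → Combination
  relation fz     = (⟦ 1ℤ ∷ 1ℤ ∷ [] ⟧ , E ∷ N ∷ E ∷ []) ∷ (⟦ 0ℤ ∷ -1ℤ ∷ [] ⟧ , E ∷ E ∷ N ∷ [])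
                      ∷ (⟦ -1ℤ ∷ [] ⟧ , N ∷ E ∷ E ∷ []) ∷ []
  relation (fs _) = (⟦ 1ℤ ∷ 1ℤ ∷ [] ⟧ , N ∷ E ∷ N ∷ []) ∷ (⟦ 0ℤ ∷ -1ℤ ∷ [] ⟧ , E ∷ N ∷ N ∷ [])
                      ∷ (⟦ -1ℤ ∷ [] ⟧ , N ∷ N ∷ E ∷ []) ∷ []

  generator : Word → Fin 2 → Word → Combination
  generator u j v = map (λ { (a , x) → a , u ++ x ++ v }) (relation j)

  IdealElement : Set
  IdealElement = List (RatFun × Word × Fin 2 × Word)

  ideal : IdealElement → Combination
  ideal []                    = []
  ideal ((c , u , j , v) ∷ L) = scale c (generator u j v) ++ ideal L

  -- X − Y agrees coefficientwise with an explicit element of the two-sided ideal: EqP, with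
  -- the nonvanishing of denominators built into RatFun.
  infix 4 _∼_
  infix 1 _by_
  record _∼_ (X Y : Combination) : Set where
    constructor _by_
    field
      witness      : IdealElement
      coefficients : ∀ x → coefficient x X ≃ coefficient x Y + coefficient x (ideal witness)

  ∼-by-coefficients : ∀ {X Y} → (∀ x → coefficient x X ≃ coefficient x Y) → X ∼ Y
  ∼-by-coefficients X≃Y = [] by λ x → ≃-trans (X≃Y x) (≃-sym (+-identityʳ _))
    where +-identityʳ : ∀ x → x + 0# ≃ x
          +-identityʳ = solve-∀ almostCommutativeRing

  ∼-single : ∀ {a b} w → a ≃ b → (a , w) ∷ [] ∼ (b , w) ∷ []
  ∼-single w a≃b = ∼-by-coefficients λ x → ≃-trans (coefficient-∷ x _ w [])
    (≃-trans (+-cong (*-cong (≃-refl {[ eqW x w ]}) a≃b) (≃-refl {0#})) (≃-sym (coefficient-∷ x _ w [])))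

  ∼-reflexive : ∀ {X Y} → X ≡ Y → X ∼ Y
  ∼-reflexive refl = ∼-by-coefficients λ x → ≃-refl

  ideal-++ : ∀ L M → ideal (L ++ M) ≡ ideal L ++ ideal M
  ideal-++ []                    M = refl
  ideal-++ ((c , u , j , v) ∷ L) M =
    trans (cong (scale c (generator u j v) ++_) (ideal-++ L M)) (sym (++-assoc (scale c (generator u j v)) _ _))

  coefficient-ideal-++ : ∀ x L M → coefficient x (ideal (L ++ M)) ≃ coefficient x (ideal L) + coefficient x (ideal M)
  coefficient-ideal-++ x L M = subst (λ Z → coefficient x Z ≃ coefficient x (ideal L) + coefficient x (ideal M))
                                     (sym (ideal-++ L M)) (coefficient-++ x (ideal L) (ideal M))

  scaleIdeal : RatFun → IdealElement → IdealElement
  scaleIdeal c = map λ { (a , u , j , v) → c * a , u , j , v }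

  coefficient-scaleIdeal : ∀ x c L → coefficient x (ideal (scaleIdeal c L)) ≃ c * coefficient x (ideal L)
  coefficient-scaleIdeal x c [] = ≃-sym (x*0≃0 c)
    where x*0≃0 : ∀ x → x * 0# ≃ 0#
          x*0≃0 = solve-∀ almostCommutativeRing
  coefficient-scaleIdeal x c ((a , u , j , v) ∷ L) = begin
    coefficient x (scale (c * a) G ++ ideal (scaleIdeal c L))
      ≈⟨ coefficient-++ x (scale (c * a) G) (ideal (scaleIdeal c L)) ⟩
    coefficient x (scale (c * a) G) + coefficient x (ideal (scaleIdeal c L))
      ≈⟨ +-cong (coefficient-scale x (c * a) G) (coefficient-scaleIdeal x c L) ⟩
    c * a * coefficient x G + c * coefficient x (ideal L)
      ≈⟨ factor c a (coefficient x G) (coefficient x (ideal L)) ⟩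
    c * (a * coefficient x G + coefficient x (ideal L))
      ≈⟨ *-cong ≃-refl (+-cong (≃-sym (coefficient-scale x a G)) ≃-refl) ⟩
    c * (coefficient x (scale a G) + coefficient x (ideal L))
      ≈⟨ *-cong ≃-refl (≃-sym (coefficient-++ x (scale a G) (ideal L))) ⟩
    c * coefficient x (ideal ((a , u , j , v) ∷ L)) ∎
    where
    G : Combination
    G = generator u j v
    factor : ∀ c a g l → c * a * g + c * l ≃ c * (a * g + l)
    factor = solve-∀ almostCommutativeRing

  ∼-sym : ∀ {X Y} → X ∼ Y → Y ∼ X
  ∼-sym {X} {Y} (L by X≃Y+L) = scaleIdeal (- 1#) L by λ x → begin
    coefficient x Y
      ≈⟨ move (coefficient x Y) (coefficient x X) (coefficient x (ideal L)) ⟩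
    coefficient x X + (- 1#) * coefficient x (ideal L)
      + (coefficient x Y + coefficient x (ideal L) + - coefficient x X)
      ≈⟨ +-cong (+-cong ≃-refl (≃-sym (coefficient-scaleIdeal x (- 1#) L))) (+-cong (≃-sym (X≃Y+L x)) ≃-refl) ⟩
    coefficient x X + coefficient x (ideal (scaleIdeal (- 1#) L)) + (coefficient x X + - coefficient x X)
      ≈⟨ cancel _ _ ⟩
    coefficient x X + coefficient x (ideal (scaleIdeal (- 1#) L)) ∎
    where
    move : ∀ y x l → y ≃ x + (- 1#) * l + (y + l + - x)
    move = solve-∀ almostCommutativeRing
    cancel : ∀ a b → a + b + (a + - a) ≃ a + b
    cancel = solve-∀ almostCommutativeRing

  ∼-trans : ∀ {X Y Z} → X ∼ Y → Y ∼ Z → X ∼ Z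
  ∼-trans {X} {Y} {Z} (L by X≃Y+L) (M by Y≃Z+M) = L ++ M by λ x → begin
    coefficient x X                                                    ≈⟨ X≃Y+L x ⟩
    coefficient x Y + coefficient x (ideal L)                          ≈⟨ +-cong (Y≃Z+M x) ≃-refl ⟩
    coefficient x Z + coefficient x (ideal M) + coefficient x (ideal L) ≈⟨ shuffle _ _ _ ⟩
    coefficient x Z + (coefficient x (ideal L) + coefficient x (ideal M))
      ≈⟨ +-cong ≃-refl (≃-sym (coefficient-ideal-++ x L M)) ⟩
    coefficient x Z + coefficient x (ideal (L ++ M))                   ∎
    where shuffle : ∀ z m l → z + m + l ≃ z + (l + m)
          shuffle = solve-∀ almostCommutativeRing

  ∼-++ : ∀ {X X' Y Y'} → X ∼ X' → Y ∼ Y' → X ++ Y ∼ X' ++ Y'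
  ∼-++ {X} {X'} {Y} {Y'} (L by X≃X'+L) (M by Y≃Y'+M) = L ++ M by λ x → begin
    coefficient x (X ++ Y)                      ≈⟨ coefficient-++ x X Y ⟩
    coefficient x X + coefficient x Y           ≈⟨ +-cong (X≃X'+L x) (Y≃Y'+M x) ⟩
    coefficient x X' + coefficient x (ideal L) + (coefficient x Y' + coefficient x (ideal M))
      ≈⟨ shuffle _ _ _ _ ⟩
    coefficient x X' + coefficient x Y' + (coefficient x (ideal L) + coefficient x (ideal M))
      ≈⟨ +-cong (≃-sym (coefficient-++ x X' Y')) (≃-sym (coefficient-ideal-++ x L M)) ⟩
    coefficient x (X' ++ Y') + coefficient x (ideal (L ++ M)) ∎
    where shuffle : ∀ a l b m → a + l + (b + m) ≃ a + b + (l + m)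
          shuffle = solve-∀ almostCommutativeRing

  ∼-scale : ∀ c {X Y} → X ∼ Y → scale c X ∼ scale c Y
  ∼-scale c {X} {Y} (L by X≃Y+L) = scaleIdeal c L by λ x → begin
    coefficient x (scale c X)                            ≈⟨ coefficient-scale x c X ⟩
    c * coefficient x X                                  ≈⟨ *-cong ≃-refl (X≃Y+L x) ⟩
    c * (coefficient x Y + coefficient x (ideal L))      ≈⟨ distribˡ c _ _ ⟩
    c * coefficient x Y + c * coefficient x (ideal L)
      ≈⟨ +-cong (≃-sym (coefficient-scale x c Y)) (≃-sym (coefficient-scaleIdeal x c L)) ⟩
    coefficient x (scale c Y) + coefficient x (ideal (scaleIdeal c L)) ∎
    where distribˡ : ∀ x y z → x * (y + z) ≃ x * y + x * z
          distribˡ = solve-∀ almostCommutativeRing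

  ∼-tabulate : ∀ {n} {c c' : Fin n → RatFun} {W W' : Fin n → Word} →
               (∀ r → (c r , W r) ∷ [] ∼ (c' r , W' r) ∷ []) →
               tabulate (λ r → c r , W r) ∼ tabulate (λ r → c' r , W' r)
  ∼-tabulate {zero}  pointwise = ∼-reflexive refl
  ∼-tabulate {suc n} pointwise = ∼-++ (pointwise fz) (∼-tabulate (λ r → pointwise (fs r)))

  ∼-setoid : Setoid _ _
  ∼-setoid = record
    { Carrier = Combination ; _≈_ = _∼_
    ; isEquivalence = record { refl = ∼-reflexive refl ; sym = ∼-sym ; trans = ∼-trans } }

  module ∼-Reasoning = Reasoning ∼-setoid

  prefix : Word → Combination → Combination
  prefix p = map λ { (a , u) → a , p ++ u }

  prefixIdeal : Word → IdealElement → IdealElement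
  prefixIdeal p = map λ { (a , u , j , v) → a , p ++ u , j , v }

  ideal-prefix : ∀ p L → ideal (prefixIdeal p L) ≡ prefix p (ideal L)
  ideal-prefix p []                    = refl
  ideal-prefix p ((c , u , j , v) ∷ L) =
    trans (cong₂ _++_ (generator-prefix j) (ideal-prefix p L)) (sym (map-++ _ (scale c (generator u j v)) (ideal L)))
    where
    generator-prefix : ∀ j → scale c (generator (p ++ u) j v) ≡ prefix p (scale c (generator u j v))
    generator-prefix fz rewrite ++-assoc p u (E ∷ N ∷ E ∷ v) | ++-assoc p u (E ∷ E ∷ N ∷ v)
                              | ++-assoc p u (N ∷ E ∷ E ∷ v) = refl
    generator-prefix (fs _) rewrite ++-assoc p u (N ∷ E ∷ N ∷ v) | ++-assoc p u (E ∷ N ∷ N ∷ v)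
                                  | ++-assoc p u (N ∷ N ∷ E ∷ v) = refl

  scale-prefix-tabulate : ∀ a p {n} (c : Fin n → RatFun) (W : Fin n → Word) →
    scale a (prefix p (tabulate (λ r → c r , W r))) ≡ tabulate (λ r → a * c r , p ++ W r)
  scale-prefix-tabulate a p c W =
    trans (cong (scale a) (map-tabulate (λ r → c r , W r) _)) (map-tabulate (λ r → c r , p ++ W r) _)

  eqL-refl : ∀ l → eqL l l ≡ true
  eqL-refl N = refl
  eqL-refl E = refl

  eqW-++ˡ : ∀ p x u → eqW (p ++ x) (p ++ u) ≡ eqW x u
  eqW-++ˡ []      x u = refl
  eqW-++ˡ (l ∷ p) x u rewrite eqL-refl l = eqW-++ˡ p x u

  stripPrefix : ∀ p x → (∃ λ x' → x ≡ p ++ x') ⊎ (∀ u → eqW x (p ++ u) ≡ false)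
  stripPrefix []      x       = inj₁ (x , refl)
  stripPrefix (l ∷ p) []      = inj₂ λ u → refl
  stripPrefix (N ∷ p) (E ∷ x) = inj₂ λ u → refl
  stripPrefix (E ∷ p) (N ∷ x) = inj₂ λ u → refl
  stripPrefix (N ∷ p) (N ∷ x) with stripPrefix p x
  ... | inj₁ (x' , x≡px') = inj₁ (x' , cong (N ∷_) x≡px')
  ... | inj₂ x∉p++        = inj₂ x∉p++
  stripPrefix (E ∷ p) (E ∷ x) with stripPrefix p x
  ... | inj₁ (x' , x≡px') = inj₁ (x' , cong (E ∷_) x≡px')
  ... | inj₂ x∉p++        = inj₂ x∉p++

  coefficient-prefix : ∀ p x Z → coefficient (p ++ x) (prefix p Z) ≡ coefficient x Z
  coefficient-prefix p x []            = refl
  coefficient-prefix p x ((a , u) ∷ Z) rewrite eqW-++ˡ p x u | coefficient-prefix p x Z = refl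

  coefficient-prefix-∉ : ∀ p x Z → (∀ u → eqW x (p ++ u) ≡ false) → coefficient x (prefix p Z) ≡ 0#
  coefficient-prefix-∉ p x []            x∉p++ = refl
  coefficient-prefix-∉ p x ((a , u) ∷ Z) x∉p++ rewrite x∉p++ u = coefficient-prefix-∉ p x Z x∉p++

  ∼-prefix : ∀ p {X Y} → X ∼ Y → prefix p X ∼ prefix p Y
  ∼-prefix p {X} {Y} (L by X≃Y+L) = prefixIdeal p L by coefficients
    where
    coefficients : ∀ x → coefficient x (prefix p X) ≃ coefficient x (prefix p Y) + coefficient x (ideal (prefixIdeal p L))
    coefficients x rewrite ideal-prefix p L with stripPrefix p x
    ... | inj₁ (x' , refl) rewrite coefficient-prefix p x' X | coefficient-prefix p x' Y
                                  | coefficient-prefix p x' (ideal L) = X≃Y+L x'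
    ... | inj₂ x∉p++ rewrite coefficient-prefix-∉ p x X x∉p++ | coefficient-prefix-∉ p x Y x∉p++
                           | coefficient-prefix-∉ p x (ideal L) x∉p++ = ≃-sym (+-identityˡ 0#)

  forgetIdeal : IdealElement → IdealComb
  forgetIdeal = map λ { (a , u , j , v) → frac a , u , j , v }

  expand-forgetIdeal : ∀ L → expand (forgetIdeal L) ≡ ⌊ ideal L ⌋
  expand-forgetIdeal []                    = refl
  expand-forgetIdeal ((c , u , j , v) ∷ L) =
    trans (cong₂ _++_ (⌊scale-generator⌋ c j) (expand-forgetIdeal L)) (sym (map-++ _ (scale c (generator u j v)) (ideal L)))
    where
    ⌊scale-generator⌋ : ∀ c j → scaleᴱ (frac c) (gen u j v) ≡ ⌊ scale c (generator u j v) ⌋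
    ⌊scale-generator⌋ (mk _ _) fz     = refl
    ⌊scale-generator⌋ (mk _ _) (fs _) = refl

  ⌊⌋-−ᴱ : ∀ X Y → ⌊ X ⌋ −ᴱ ⌊ Y ⌋ ≡ ⌊ X ++ negate Y ⌋
  ⌊⌋-−ᴱ X Y = trans (cong (⌊ X ⌋ ++_) (⌊⌋-negate Y)) (sym (map-++ _ X (negate Y)))
    where
    ⌊⌋-negate : ∀ Y → map (λ { (a , u) → negF a , u }) ⌊ Y ⌋ ≡ ⌊ negate Y ⌋
    ⌊⌋-negate []            = refl
    ⌊⌋-negate ((a , u) ∷ Y) = cong₂ _∷_ (cong (_, u) (sym (frac-- a))) (⌊⌋-negate Y)

  ∼⇒EqP : ∀ {X Y} → X ∼ Y → EqP ⌊ X ⌋ ⌊ Y ⌋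
  ∼⇒EqP {X} {Y} (L by X≃Y+L) = forgetIdeal L , denominators≉0 L , λ x →
    subst₂ (λ A B → coefW x A ≈F coefW x B) (sym (⌊⌋-−ᴱ X Y)) (sym (expand-forgetIdeal L))
      (subst₂ _≈F_ (sym (coefW-⌊⌋ x (X ++ negate Y))) (sym (coefW-⌊⌋ x (ideal L))) (coeff-≡ (cross (difference x))))
    where
    denominators≉0 : ∀ L → All (λ t → NonZeroDen (proj₁ t)) (forgetIdeal L)
    denominators≉0 []                    = []
    denominators≉0 ((a , u , j , v) ∷ L) = (λ den≈ₚ[] → den≉0 a (mk≈ den≈ₚ[])) ∷ denominators≉0 L
    difference : ∀ x → coefficient x (X ++ negate Y) ≃ coefficient x (ideal L)
    difference x = begin
      coefficient x (X ++ negate Y)                              ≈⟨ coefficient-++ x X (negate Y) ⟩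
      coefficient x X + coefficient x (negate Y)                 ≈⟨ +-cong (X≃Y+L x) (coefficient-negate x Y) ⟩
      coefficient x Y + coefficient x (ideal L) + - coefficient x Y ≈⟨ cancel _ _ ⟩
      coefficient x (ideal L)                                    ∎
      where cancel : ∀ y l → y + l + - y ≃ l
            cancel = solve-∀ almostCommutativeRing

-- Moving an adjacent pair en or ne to the front of a word

module Straightening where

  open Polynomial using (mk≈)
  open RationalFunctions
  open LinearCombinations
  open ≃-Reasoning

  ⟨_,_⟩·_ : RatFun → RatFun → Word → Combination
  ⟨ a , b ⟩· X = (a , sW ++ X) ∷ (b , tW ++ X) ∷ []

  ⟦-1⟧ : ⟦ -1ℤ ∷ [] ⟧ ≃ - 1#
  ⟦-1⟧ = mk≃ (mk≈ λ { 0 → refl ; (suc i) → refl })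

  ⟦0⟧ : ⟦ 0ℤ ∷ [] ⟧ ≃ 0#
  ⟦0⟧ = mk≃ (mk≈ λ { 0 → refl ; (suc i) → refl })

  ⟦1+q⟧ : ⟦ 1ℤ ∷ 1ℤ ∷ [] ⟧ ≃ 1# + q
  ⟦1+q⟧ = ≃-trans (⟦∷⟧ 1ℤ (1ℤ ∷ [])) (identity q)
    where identity : ∀ q → 1# + q * 1# ≃ 1# + q
          identity = solve-∀ almostCommutativeRing

  ⟦-q⟧ : ⟦ 0ℤ ∷ -1ℤ ∷ [] ⟧ ≃ - q
  ⟦-q⟧ = ≃-trans (⟦∷⟧ 0ℤ (-1ℤ ∷ [])) (≃-trans (+-cong ⟦0⟧ (*-cong ≃-refl ⟦-1⟧)) (identity q))
    where identity : ∀ q → 0# + q * - 1# ≃ - q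
          identity = solve-∀ almostCommutativeRing

  coefficient-pair : ∀ x a u b v → coefficient x ((a , u) ∷ (b , v) ∷ []) ≃ [ eqW x u ] * a + ([ eqW x v ] * b + 0#)
  coefficient-pair x a u b v =
    ≃-trans (coefficient-∷ x a u ((b , v) ∷ [])) (+-cong {[ eqW x u ] * a} ≃-refl (coefficient-∷ x b v []))

  coefficient-triple : ∀ x a u b v c w → coefficient x ((a , u) ∷ (b , v) ∷ (c , w) ∷ []) ≃
                       [ eqW x u ] * a + ([ eqW x v ] * b + ([ eqW x w ] * c + 0#))
  coefficient-triple x a u b v c w =
    ≃-trans (coefficient-∷ x a u ((b , v) ∷ (c , w) ∷ [])) (+-cong {[ eqW x u ] * a} ≃-refl (coefficient-pair x b v c w))

  coefficient-generatorᴱ : ∀ x X → coefficient x (generator [] fz X) ≃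
    [ eqW x (E ∷ N ∷ E ∷ X) ] * (1# + q) + ([ eqW x (E ∷ E ∷ N ∷ X) ] * - q + ([ eqW x (N ∷ E ∷ E ∷ X) ] * - 1# + 0#))
  coefficient-generatorᴱ x X = ≃-trans (coefficient-triple x _ _ _ _ _ _)
    (+-cong (*-cong ≃-refl ⟦1+q⟧) (+-cong (*-cong ≃-refl ⟦-q⟧) (+-cong (*-cong ≃-refl ⟦-1⟧) ≃-refl)))

  coefficient-generatorᴺ : ∀ x X → coefficient x (generator [] (fs fz) X) ≃
    [ eqW x (N ∷ E ∷ N ∷ X) ] * (1# + q) + ([ eqW x (E ∷ N ∷ N ∷ X) ] * - q + ([ eqW x (N ∷ N ∷ E ∷ X) ] * - 1# + 0#))
  coefficient-generatorᴺ x X = ≃-trans (coefficient-triple x _ _ _ _ _ _)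
    (+-cong (*-cong ≃-refl ⟦1+q⟧) (+-cong (*-cong ≃-refl ⟦-q⟧) (+-cong (*-cong ≃-refl ⟦-1⟧) ≃-refl)))

  coefficient-ideal-∷[] : ∀ x c u j v → coefficient x (ideal ((c , u , j , v) ∷ [])) ≃ c * coefficient x (generator u j v)
  coefficient-ideal-∷[] x c u j v = ≃-trans (coefficient-++ x (scale c G) [])
    (≃-trans (+-identityʳ _) (coefficient-scale x c G))
    where
    G : Combination
    G = generator u j v
    +-identityʳ : ∀ x → x + 0# ≃ x
    +-identityʳ = solve-∀ almostCommutativeRing

  -- e(a s + b t)X − (a' s + b' t)eX = b' R₀ X,  with R₀ = (1+q) ene − q een − nee.
  straighten-E : ∀ {a b a' b'} X → a ≃ - (q * b') → b ≃ a' + (1# + q) * b' →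
                 prefix (E ∷ []) (⟨ a , b ⟩· X) ∼ ⟨ a' , b' ⟩· (E ∷ X)
  straighten-E {a} {b} {a'} {b'} X a≃ b≃ = (b' , [] , fz , X) ∷ [] by λ x →
    let een = [ eqW x (E ∷ E ∷ N ∷ X) ] ; ene = [ eqW x (E ∷ N ∷ E ∷ X) ] ; nee = [ eqW x (N ∷ E ∷ E ∷ X) ] in
    begin
    coefficient x (prefix (E ∷ []) (⟨ a , b ⟩· X))
      ≈⟨ coefficient-pair x a (E ∷ E ∷ N ∷ X) b (E ∷ N ∷ E ∷ X) ⟩
    een * a + (ene * b + 0#)
      ≈⟨ +-cong (*-cong ≃-refl a≃) (+-cong (*-cong ≃-refl b≃) ≃-refl) ⟩
    een * - (q * b') + (ene * (a' + (1# + q) * b') + 0#)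
      ≈⟨ identity een ene nee q a' b' ⟩
    (ene * a' + (nee * b' + 0#)) + b' * (ene * (1# + q) + (een * - q + (nee * - 1# + 0#)))
      ≈⟨ ≃-sym (+-cong (coefficient-pair x a' (E ∷ N ∷ E ∷ X) b' (N ∷ E ∷ E ∷ X))
                       (≃-trans (coefficient-ideal-∷[] x b' [] fz X) (*-cong ≃-refl (coefficient-generatorᴱ x X)))) ⟩
    coefficient x (⟨ a' , b' ⟩· (E ∷ X)) + coefficient x (ideal ((b' , [] , fz , X) ∷ [])) ∎
    where
    identity : ∀ een ene nee q a' b' →
      een * - (q * b') + (ene * (a' + (1# + q) * b') + 0#) ≃
      (ene * a' + (nee * b' + 0#)) + b' * (ene * (1# + q) + (een * - q + (nee * - 1# + 0#)))
    identity = solve-∀ almostCommutativeRing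

  -- n(a s + b t)X − (a'' s + b'' t)nX = −b R₁ X,  with R₁ = (1+q) nen − q enn − nne.
  straighten-N : ∀ {a b a'' b''} X → a'' ≃ - (q * b) → b'' ≃ a + (1# + q) * b →
                 prefix (N ∷ []) (⟨ a , b ⟩· X) ∼ ⟨ a'' , b'' ⟩· (N ∷ X)
  straighten-N {a} {b} {a''} {b''} X a''≃ b''≃ = (- b , [] , fs fz , X) ∷ [] by λ x →
    let nen = [ eqW x (N ∷ E ∷ N ∷ X) ] ; nne = [ eqW x (N ∷ N ∷ E ∷ X) ] ; enn = [ eqW x (E ∷ N ∷ N ∷ X) ] in
    begin
    coefficient x (prefix (N ∷ []) (⟨ a , b ⟩· X))
      ≈⟨ coefficient-pair x a (N ∷ E ∷ N ∷ X) b (N ∷ N ∷ E ∷ X) ⟩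
    nen * a + (nne * b + 0#)
      ≈⟨ identity nen nne enn q a b ⟩
    (enn * - (q * b) + (nen * (a + (1# + q) * b) + 0#)) + - b * (nen * (1# + q) + (enn * - q + (nne * - 1# + 0#)))
      ≈⟨ +-cong (+-cong (*-cong ≃-refl (≃-sym a''≃)) (+-cong (*-cong ≃-refl (≃-sym b''≃)) ≃-refl)) ≃-refl ⟩
    (enn * a'' + (nen * b'' + 0#)) + - b * (nen * (1# + q) + (enn * - q + (nne * - 1# + 0#)))
      ≈⟨ ≃-sym (+-cong (coefficient-pair x a'' (E ∷ N ∷ N ∷ X) b'' (N ∷ E ∷ N ∷ X))
                       (≃-trans (coefficient-ideal-∷[] x (- b) [] (fs fz) X) (*-cong ≃-refl (coefficient-generatorᴺ x X)))) ⟩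
    coefficient x (⟨ a'' , b'' ⟩· (N ∷ X)) + coefficient x (ideal ((- b , [] , fs fz , X) ∷ [])) ∎
    where
    identity : ∀ nen nne enn q a b →
      nen * a + (nne * b + 0#) ≃
      (enn * - (q * b) + (nen * (a + (1# + q) * b) + 0#)) + - b * (nen * (1# + q) + (enn * - q + (nne * - 1# + 0#)))
    identity = solve-∀ almostCommutativeRing

  qInteger : ℕ → Poly
  qInteger j = replicate j 1ℤ

  ⟦qInteger-suc⟧ : ∀ j → ⟦ qInteger (suc j) ⟧ ≃ 1# + q * ⟦ qInteger j ⟧
  ⟦qInteger-suc⟧ j = ⟦∷⟧ 1ℤ (qInteger j)

  -- Closed forms of the unique solution of  α (k+1) = −q β k,  β (k+1) = α k + (1+q) β k
  -- with α 0 = 1, β 0 = 0.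
  α β : ℤ → RatFun
  α +[1+ j ]  = - (q * ⟦ qInteger j ⟧)
  α (+ zero)  = 1#
  α -[1+ j ]  = q⁻¹^ (suc j) * ⟦ qInteger (suc (suc j)) ⟧
  β +[1+ j ]  = ⟦ qInteger (suc j) ⟧
  β (+ zero)  = 0#
  β -[1+ j ]  = - (q⁻¹^ (suc j) * ⟦ qInteger (suc j) ⟧)

  α-suc : ∀ k → α (ℤ.suc k) ≃ - (q * β k)
  α-suc (+ zero)         = ≃-refl
  α-suc +[1+ j ]         = ≃-refl
  α-suc -[1+ zero ]      = ≃-modulo q*q⁻¹≃1 (identity q q⁻¹)
    where identity : ∀ q r → 1# ≃ - (q * - ((r * 1#) * 1#)) + - 1# * (q * r + - 1#)
          identity = solve-∀ almostCommutativeRing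
  α-suc -[1+ suc j ]     = ≃-modulo q*q⁻¹≃1 (identity q q⁻¹ (q⁻¹^ (suc j)) ⟦ qInteger (suc (suc j)) ⟧)
    where identity : ∀ q r P Q → P * Q ≃ - (q * - ((r * P) * Q)) + - (P * Q) * (q * r + - 1#)
          identity = solve-∀ almostCommutativeRing

  β-suc : ∀ k → β (ℤ.suc k) ≃ α k + (1# + q) * β k
  β-suc (+ zero)         = identity q
    where identity : ∀ q → 1# ≃ 1# + (1# + q) * 0#
          identity = solve-∀ almostCommutativeRing
  β-suc +[1+ j ]         = begin
    ⟦ qInteger (suc (suc j)) ⟧                              ≈⟨ ⟦qInteger-suc⟧ (suc j) ⟩
    1# + q * ⟦ qInteger (suc j) ⟧                           ≈⟨ +-cong ≃-refl (*-cong ≃-refl (⟦qInteger-suc⟧ j)) ⟩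
    1# + q * (1# + q * Q)                                   ≈⟨ identity q Q ⟩
    - (q * Q) + (1# + q) * (1# + q * Q)                     ≈⟨ +-cong ≃-refl (*-cong ≃-refl (≃-sym (⟦qInteger-suc⟧ j))) ⟩
    - (q * Q) + (1# + q) * ⟦ qInteger (suc j) ⟧             ∎
    where
    Q : RatFun
    Q = ⟦ qInteger j ⟧
    identity : ∀ q Q → 1# + q * (1# + q * Q) ≃ - (q * Q) + (1# + q) * (1# + q * Q)
    identity = solve-∀ almostCommutativeRing
  β-suc -[1+ zero ]      = ≃-trans (identity q q⁻¹) (+-cong (*-cong ≃-refl (≃-sym ⟦1+q⟧)) ≃-refl)
    where identity : ∀ q r → 0# ≃ (r * 1#) * (1# + q) + (1# + q) * - ((r * 1#) * 1#)
          identity = solve-∀ almostCommutativeRing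
  β-suc -[1+ suc j ]     = begin
    - (P * Q₁)
      ≈⟨ ≃-modulo q*q⁻¹≃1 (≃-modulo (⟦qInteger-suc⟧ (suc j)) (identity q q⁻¹ P Q₁ Q₂)) ⟩
    (q⁻¹ * P) * (1# + q * Q₂) + (1# + q) * - ((q⁻¹ * P) * Q₂)
      ≈⟨ +-cong (*-cong ≃-refl (≃-sym (⟦qInteger-suc⟧ (suc (suc j))))) ≃-refl ⟩
    (q⁻¹ * P) * ⟦ qInteger (suc (suc (suc j))) ⟧ + (1# + q) * - ((q⁻¹ * P) * Q₂) ∎
    where
    P : RatFun
    P = q⁻¹^ (suc j)
    Q₁ : RatFun
    Q₁ = ⟦ qInteger (suc j) ⟧
    Q₂ : RatFun
    Q₂ = ⟦ qInteger (suc (suc j)) ⟧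
    identity : ∀ q r P Q₁ Q₂ →
      - (P * Q₁) ≃ ((r * P) * (1# + q * Q₂) + (1# + q) * - ((r * P) * Q₂) + (P * Q₁) * (q * r + - 1#))
                   + (r * P) * (Q₂ + - (1# + q * Q₁))
    identity = solve-∀ almostCommutativeRing

  height : ℤ → Word → ℤ
  height k []      = k
  height k (N ∷ u) = ℤ.suc (height k u)
  height k (E ∷ u) = ℤ.pred (height k u)

  straighten : ∀ k u X → prefix u (⟨ α k , β k ⟩· X) ∼ ⟨ α (height k u) , β (height k u) ⟩· (u ++ X)
  straighten k []      X = ∼-reflexive refl
  straighten k (N ∷ u) X = ∼-trans (∼-prefix (N ∷ []) (straighten k u X))
    (straighten-N (u ++ X) (α-suc (height k u)) (β-suc (height k u)))
  straighten k (E ∷ u) X = ∼-trans (∼-prefix (E ∷ []) (straighten k u X))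
    (straighten-E (u ++ X) (subst (λ i → α i ≃ - (q * β h⁻)) (ℤ.suc-pred h) (α-suc h⁻))
                           (subst (λ i → β i ≃ α h⁻ + (1# + q) * β h⁻) (ℤ.suc-pred h) (β-suc h⁻)))
    where
    h : ℤ
    h = height k u
    h⁻ : ℤ
    h⁻ = ℤ.pred h

  data Pair : Set where
    en ne : Pair

  pairWord : Pair → Word
  pairWord en = sW
  pairWord ne = tW

  initialHeight : Pair → ℤ
  initialHeight en = + 0
  initialHeight ne = + 1

  pair∼ : ∀ P X → (1# , pairWord P ++ X) ∷ [] ∼ ⟨ α (initialHeight P) , β (initialHeight P) ⟩· X
  pair∼ en X = ∼-by-coefficients λ x → begin
    coefficient x ((1# , E ∷ N ∷ X) ∷ [])          ≈⟨ coefficient-∷ x 1# (E ∷ N ∷ X) [] ⟩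
    [ eqW x (E ∷ N ∷ X) ] * 1# + 0#                 ≈⟨ identity _ _ ⟩
    [ eqW x (E ∷ N ∷ X) ] * 1# + ([ eqW x (N ∷ E ∷ X) ] * 0# + 0#) ≈⟨ ≃-sym (coefficient-pair x 1# _ 0# _) ⟩
    coefficient x (⟨ 1# , 0# ⟩· X)                  ∎
    where identity : ∀ a b → a * 1# + 0# ≃ a * 1# + (b * 0# + 0#)
          identity = solve-∀ almostCommutativeRing
  pair∼ ne X = ∼-by-coefficients λ x → begin
    coefficient x ((1# , N ∷ E ∷ X) ∷ [])          ≈⟨ coefficient-∷ x 1# (N ∷ E ∷ X) [] ⟩
    [ eqW x (N ∷ E ∷ X) ] * 1# + 0#                 ≈⟨ identity _ _ q ⟩
    [ eqW x (E ∷ N ∷ X) ] * - (q * 0#) + ([ eqW x (N ∷ E ∷ X) ] * 1# + 0#) ≈⟨ ≃-sym (coefficient-pair x _ _ 1# _) ⟩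
    coefficient x (⟨ - (q * 0#) , 1# ⟩· X)          ∎
    where identity : ∀ b a q → a * 1# + 0# ≃ b * - (q * 0#) + (a * 1# + 0#)
          identity = solve-∀ almostCommutativeRing

  move-pair : ∀ P u v → (1# , u ++ pairWord P ++ v) ∷ [] ∼
                        ⟨ α (height (initialHeight P) u) , β (height (initialHeight P) u) ⟩· (u ++ v)
  move-pair P u v = ∼-trans (∼-prefix u (pair∼ P v)) (straighten (initialHeight P) u v)

module SignedLaurentPolynomials where

  open Polynomial using (_≈_; mk≈; ≈-refl; ≈-sym; ≈-trans; 1ₚ)
  private module P = Polynomial
  open RationalFunctions

  Nonneg : Poly → Set
  Nonneg = All (0ℤ ℤ.≤_)

  nonneg-+ : ∀ {p r} → Nonneg p → Nonneg r → Nonneg (p +ₚ r)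
  nonneg-+ []         r≥0        = r≥0
  nonneg-+ (a≥0 ∷ p≥0) []         = a≥0 ∷ p≥0
  nonneg-+ (a≥0 ∷ p≥0) (b≥0 ∷ r≥0) = ℤ.+-mono-≤ a≥0 b≥0 ∷ nonneg-+ p≥0 r≥0

  nonneg-scale : ∀ {c p} → 0ℤ ℤ.≤ c → Nonneg p → Nonneg (scaleₚ c p)
  nonneg-scale                      c≥0 []              = []
  nonneg-scale {+ c} {+ a ∷ p} c≥0 (ℤ.+≤+ _ ∷ p≥0) =
    subst (0ℤ ℤ.≤_) (ℤ.pos-* c a) (ℤ.+≤+ z≤n) ∷ nonneg-scale c≥0 p≥0

  nonneg-* : ∀ {p r} → Nonneg p → Nonneg r → Nonneg (p *ₚ r)
  nonneg-* []          r≥0 = []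
  nonneg-* (a≥0 ∷ p≥0) r≥0 = nonneg-+ (nonneg-scale a≥0 r≥0) (ℤ.+≤+ z≤n ∷ nonneg-* p≥0 r≥0)

  nonneg-replicate : ∀ {a} j → 0ℤ ℤ.≤ a → Nonneg (replicate j a)
  nonneg-replicate zero    a≥0 = []
  nonneg-replicate (suc j) a≥0 = a≥0 ∷ nonneg-replicate j a≥0

  flip : PM → PM
  flip plus  = minus
  flip minus = plus

  _·_ : PM → PM → PM
  plus  · s = s
  minus · s = flip s

  ± : PM → RatFun
  ± s = ⟦ signVal s ∷ [] ⟧

  ±-flip : ∀ s → ± (flip s) ≃ - ± s
  ±-flip plus  = mk≃ (mk≈ λ { 0 → refl ; (suc i) → refl })
  ±-flip minus = mk≃ (mk≈ λ { 0 → refl ; (suc i) → refl })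

  ±-· : ∀ s t → ± (s · t) ≃ ± s * ± t
  ±-· plus  t = ≃-sym (*-identityˡ (± t))
  ±-· minus plus  = mk≃ (mk≈ λ { 0 → refl ; (suc i) → refl })
  ±-· minus minus = mk≃ (mk≈ λ { 0 → refl ; (suc i) → refl })

  alternating : PM → ℕ → PM
  alternating σ zero    = σ
  alternating σ (suc r) = flip (alternating σ r)

  alternating-flip : ∀ σ r → alternating (flip σ) r ≡ flip (alternating σ r)
  alternating-flip σ zero    = refl
  alternating-flip σ (suc r) = cong flip (alternating-flip σ r)

  alternating-· : ∀ ε σ r → alternating (ε · σ) r ≡ ε · alternating σ r
  alternating-· plus  σ r = refl
  alternating-· minus σ r = alternating-flip σ r

  qPow≉[] : ∀ K → ¬ qPow K ≈ []
  qPow≉[] K qPow≈[] = case trans (sym (leading K)) (P.coeff-≡ qPow≈[] K) of λ ()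
    where leading : ∀ K → coeff (qPow K) K ≡ 1ℤ
          leading zero    = refl
          leading (suc K) = leading K

  q⁻¹^≃ : ∀ K → q⁻¹^ K ≃ mk (1ₚ / qPow K) (qPow≉[] K)
  q⁻¹^≃ zero    = ≃-refl
  q⁻¹^≃ (suc K) = ≃-trans (*-cong ≃-refl (q⁻¹^≃ K)) q⁻¹*1/d≃1/qd

  q⁻¹^-+ : ∀ e K → q⁻¹^ (e ℕ.+ K) ≃ q⁻¹^ e * q⁻¹^ K
  q⁻¹^-+ zero    K = ≃-sym (*-identityˡ _)
  q⁻¹^-+ (suc e) K = ≃-trans (*-cong ≃-refl (q⁻¹^-+ e K)) (≃-sym (*-assoc q⁻¹ _ _))

  ratFun : SignedLaurent → RatFun
  ratFun c = mk (toFrac c) (qPow≉[] (shift c))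

  ratFun≃ : ∀ c → ratFun c ≃ ± (sign c) * ⟦ poly c ⟧ * q⁻¹^ (shift c)
  ratFun≃ c = ≃-sym (≃-trans (*-cong ≃-refl (q⁻¹^≃ (shift c))) (mk≃ (≈-trans
    (law (signVal (sign c) ∷ []) (poly c) (qPow (shift c)))
    (P.*-congʳ ((1ₚ *ₚ 1ₚ) *ₚ qPow (shift c)) (scale≈ (signVal (sign c)) (poly c))))))
    where
    law : ∀ S p Q → (((S *ₚ p) *ₚ 1ₚ) *ₚ Q) ≈ ((S *ₚ p) *ₚ ((1ₚ *ₚ 1ₚ) *ₚ Q))
    law = solve-∀ P.almostCommutativeRing
    scale≈ : ∀ s p → ((s ∷ []) *ₚ p) ≈ scaleₚ s p
    scale≈ s p = ≈-trans (P.+-cong {scaleₚ s p} ≈-refl (P.∷-≈[] refl ≈-refl)) (P.+-identityʳ (scaleₚ s p))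

  open Straightening using (α; β; qInteger; ⟦qInteger-suc⟧; ⟦-1⟧; ⟦0⟧)

  -- The opposite signs of a and b are what keep the expansions below sign-alternating.
  record SignedPair (a b : RatFun) : Set where
    field
      ε       : PM
      e       : ℕ
      A B     : Poly
      A≥0     : Nonneg A
      B≥0     : Nonneg B
      a≃      : a ≃ ± ε * ⟦ A ⟧ * q⁻¹^ e
      b≃      : b ≃ - (± ε * ⟦ B ⟧ * q⁻¹^ e)

  αβ-signed : ∀ k → SignedPair (α k) (β k)
  αβ-signed +[1+ j ] = record
    { ε = minus ; e = 0 ; A = 0ℤ ∷ qInteger j ; B = qInteger (suc j)
    ; A≥0 = ℤ.+≤+ z≤n ∷ nonneg-replicate j (ℤ.+≤+ z≤n) ; B≥0 = nonneg-replicate (suc j) (ℤ.+≤+ z≤n)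
    ; a≃ = ≃-trans (identityᵃ q ⟦ qInteger j ⟧)
             (*-cong (*-cong (≃-sym ⟦-1⟧) (≃-sym (≃-trans (⟦∷⟧ 0ℤ (qInteger j)) (+-cong ⟦0⟧ (≃-refl {q * ⟦ qInteger j ⟧})))))
                     (≃-refl {1#}))
    ; b≃ = ≃-trans (identityᵇ ⟦ qInteger (suc j) ⟧)
             (-‿cong (*-cong (*-cong (≃-sym ⟦-1⟧) (≃-refl {⟦ qInteger (suc j) ⟧})) (≃-refl {1#}))) }
    where
    identityᵃ : ∀ q Q → - (q * Q) ≃ - 1# * (0# + q * Q) * 1#
    identityᵃ = solve-∀ almostCommutativeRing
    identityᵇ : ∀ Q → Q ≃ - (- 1# * Q * 1#)
    identityᵇ = solve-∀ almostCommutativeRing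
  αβ-signed (+ zero) = record
    { ε = plus ; e = 0 ; A = 1ₚ ; B = [] ; A≥0 = ℤ.+≤+ z≤n ∷ [] ; B≥0 = []
    ; a≃ = ≃-sym (identity 1#) ; b≃ = ≃-trans (≃-sym -0≃0) (≃-sym (-‿cong (identity 0#))) }
    where
    identity : ∀ x → 1# * x * 1# ≃ x
    identity = solve-∀ almostCommutativeRing
    -0≃0 : - 0# ≃ 0#
    -0≃0 = solve-∀ almostCommutativeRing
  αβ-signed -[1+ j ] = record
    { ε = plus ; e = suc j ; A = qInteger (suc (suc j)) ; B = qInteger (suc j)
    ; A≥0 = nonneg-replicate (suc (suc j)) (ℤ.+≤+ z≤n) ; B≥0 = nonneg-replicate (suc j) (ℤ.+≤+ z≤n)
    ; a≃ = identityᵃ (q⁻¹^ (suc j)) ⟦ qInteger (suc (suc j)) ⟧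
    ; b≃ = identityᵇ (q⁻¹^ (suc j)) ⟦ qInteger (suc j) ⟧ }
    where
    identityᵃ : ∀ P Q → P * Q ≃ 1# * Q * P
    identityᵃ = solve-∀ almostCommutativeRing
    identityᵇ : ∀ P Q → - (P * Q) ≃ - (1# * Q * P)
    identityᵇ = solve-∀ almostCommutativeRing

module ZigzagExpansions where

  open RationalFunctions
  open LinearCombinations
  open Straightening
  open SignedLaurentPolynomials
  open Polynomial using (1ₚ)
  open import Algebra.Properties.CommutativeMonoid.Sum (CommutativeRing.+-commutativeMonoid commutativeRing)
    using (sum; sum-cong-≋; sum-init-last; ∑-distrib-+)

  coefficient-tabulate : ∀ x {n} (c : Fin n → RatFun) (W : Fin n → Word) →
                         coefficient x (tabulate (λ r → c r , W r)) ≃ sum (λ r → [ eqW x (W r) ] * c r)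
  coefficient-tabulate x {zero}  c W = ≃-refl
  coefficient-tabulate x {suc n} c W = ≃-trans (coefficient-∷ x (c fz) (W fz) (tabulate (λ r → c (fs r) , W (fs r))))
    (+-cong (≃-refl {[ eqW x (W fz) ] * c fz}) (coefficient-tabulate x (λ r → c (fs r)) (λ r → W (fs r))))

  insertAt-preserves : ∀ {A : Set} (Q : A → Set) {n} {xs : Fin n → A} {x} →
                       (∀ r → Q (xs r)) → Q x → ∀ i r → Q (insertAt xs i x r)
  insertAt-preserves Q         Qxs Qx fz     fz     = Qx
  insertAt-preserves Q         Qxs Qx fz     (fs r) = Qxs r
  insertAt-preserves Q {suc n} Qxs Qx (fs i) fz     = Qxs fz
  insertAt-preserves Q {suc n} Qxs Qx (fs i) (fs r) = insertAt-preserves Q (λ r → Qxs (fs r)) Qx i r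

  insertAt-last-pointwise : ∀ {A B : Set} (R : ℕ → A → B → Set) {n} {xs : Fin n → A} {ys : Fin n → B} {x y} →
    (∀ r → R (toℕ r) (xs r) (ys r)) → R n x y → ∀ r → R (toℕ r) (insertAt xs (fromℕ n) x r) (insertAt ys (fromℕ n) y r)
  insertAt-last-pointwise R {zero}  Rxs Rxy fz     = Rxy
  insertAt-last-pointwise R {suc n} Rxs Rxy fz     = Rxs fz
  insertAt-last-pointwise R {suc n} Rxs Rxy (fs r) = insertAt-last-pointwise (λ k → R (suc k)) (λ r → Rxs (fs r)) Rxy r

  insertAt-last-inject₁ : ∀ {A : Set} {n} (xs : Fin n → A) v (r : Fin n) → insertAt xs (fromℕ n) v (inject₁ r) ≡ xs r
  insertAt-last-inject₁ {n = suc n} xs v fz     = refl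
  insertAt-last-inject₁ {n = suc n} xs v (fs r) = insertAt-last-inject₁ (λ j → xs (fs j)) v r

  -- a s Σ γ_r z_r + b t Σ γ_r z_r, once s z_r = W (r+1) and t z_r = W r.
  convolution : ∀ {n} a b (γ : Fin (suc n) → RatFun) (γ' : Fin (suc (suc n)) → RatFun) (W : Fin (suc (suc n)) → Word) →
    (∀ r → γ' r ≃ a * insertAt γ fz 0# r + b * insertAt γ (fromℕ (suc n)) 0# r) →
    tabulate (λ r → a * γ r , W (fs r)) ++ tabulate (λ r → b * γ r , W (inject₁ r)) ∼ tabulate (λ r → γ' r , W r)
  convolution {n} a b γ γ' W γ'≃ = ∼-by-coefficients λ x →
    let δ : Fin (suc (suc n)) → RatFun
        δ r = [ eqW x (W r) ]
        γˡ : Fin (suc (suc n)) → RatFun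
        γˡ = insertAt γ fz 0#
        γʳ : Fin (suc (suc n)) → RatFun
        γʳ = insertAt γ (fromℕ (suc n)) 0#
    in begin
    coefficient x (tabulate (λ r → a * γ r , W (fs r)) ++ tabulate (λ r → b * γ r , W (inject₁ r)))
      ≈⟨ coefficient-++ x (tabulate (λ r → a * γ r , W (fs r))) (tabulate (λ r → b * γ r , W (inject₁ r))) ⟩
    coefficient x (tabulate (λ r → a * γ r , W (fs r))) + coefficient x (tabulate (λ r → b * γ r , W (inject₁ r)))
      ≈⟨ +-cong (coefficient-tabulate x (λ r → a * γ r) (λ r → W (fs r)))
                (coefficient-tabulate x (λ r → b * γ r) (λ r → W (inject₁ r))) ⟩
    sum (λ r → δ (fs r) * (a * γ r)) + sum (λ r → δ (inject₁ r) * (b * γ r))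
      ≈⟨ +-cong (≃-sym (vanishing-head (δ fz) a (sum (λ r → δ (fs r) * (a * γ r)))))
                (≃-trans (sum-cong-≋ (λ r → *-cong (≃-refl {δ (inject₁ r)}) (*-cong (≃-refl {b})
                                        (≃-reflexive (sym (insertAt-last-inject₁ γ 0# r))))))
                         (vanishing-last (sum (λ r → δ (inject₁ r) * (b * γʳ (inject₁ r)))) (δ (fromℕ (suc n))) b)) ⟩
    sum (λ r → δ r * (a * γˡ r)) + (sum (λ r → δ (inject₁ r) * (b * γʳ (inject₁ r))) + δ (fromℕ (suc n)) * (b * 0#))
      ≈⟨ +-cong (≃-refl {sum (λ r → δ r * (a * γˡ r))})
                (+-cong (≃-refl {sum (λ r → δ (inject₁ r) * (b * γʳ (inject₁ r)))})
                        (*-cong (≃-refl {δ (fromℕ (suc n))})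
                                (*-cong (≃-refl {b}) (≃-reflexive (sym (insertAt-lookup γ (fromℕ (suc n)) 0#)))))) ⟩
    sum (λ r → δ r * (a * γˡ r))
      + (sum (λ r → δ (inject₁ r) * (b * γʳ (inject₁ r))) + δ (fromℕ (suc n)) * (b * γʳ (fromℕ (suc n))))
      ≈⟨ +-cong (≃-refl {sum (λ r → δ r * (a * γˡ r))}) (≃-sym (sum-init-last (λ r → δ r * (b * γʳ r)))) ⟩
    sum (λ r → δ r * (a * γˡ r)) + sum (λ r → δ r * (b * γʳ r))
      ≈⟨ ≃-sym (∑-distrib-+ (λ r → δ r * (a * γˡ r)) (λ r → δ r * (b * γʳ r))) ⟩
    sum (λ r → δ r * (a * γˡ r) + δ r * (b * γʳ r))
      ≈⟨ sum-cong-≋ (λ r → ≃-trans (≃-sym (distribˡ (δ r) _ _)) (*-cong (≃-refl {δ r}) (≃-sym (γ'≃ r)))) ⟩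
    sum (λ r → δ r * γ' r)
      ≈⟨ ≃-sym (coefficient-tabulate x γ' W) ⟩
    coefficient x (tabulate (λ r → γ' r , W r)) ∎
    where
    open ≃-Reasoning
    vanishing-head : ∀ d a s → d * (a * 0#) + s ≃ s
    vanishing-head = solve-∀ almostCommutativeRing
    vanishing-last : ∀ s d b → s ≃ s + d * (b * 0#)
    vanishing-last = solve-∀ almostCommutativeRing
    distribˡ : ∀ x y z → x * (y + z) ≃ x * y + x * z
    distribˡ = solve-∀ almostCommutativeRing

  sW^ : ℕ → Word
  sW^ r = concat (replicate r sW)

  height-sW^ : ∀ k r → height k (sW^ r) ≡ k
  height-sW^ k zero    = refl
  height-sW^ k (suc r) = trans (ℤ.pred-suc (height k (sW^ r))) (height-sW^ k r)

  -- t commutes with s, since moving t across s^r returns it to height 1.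
  t·sW^ : ∀ r V → (1# , tW ++ sW^ r ++ V) ∷ [] ∼ (1# , sW^ r ++ tW ++ V) ∷ []
  t·sW^ r V = ∼-trans (pair∼ ne (sW^ r ++ V))
    (∼-sym (subst (λ h → (1# , sW^ r ++ tW ++ V) ∷ [] ∼ ⟨ α h , β h ⟩· (sW^ r ++ V)) (height-sW^ (+ 1) r)
                  (move-pair ne (sW^ r) V)))

  t·zigzag : ∀ m n (r : Fin (suc n)) →
             (1# , tW ++ zigzag m n (toℕ r)) ∷ [] ∼ (1# , zigzag (suc m) (suc n) (toℕ (inject₁ r))) ∷ []
  t·zigzag m n r = subst (λ z → (1# , tW ++ zigzag m n (toℕ r)) ∷ [] ∼ (1# , z) ∷ []) (sym zigzag≡)
    (t·sW^ (toℕ r) (concat (replicate (n ∸ toℕ r) tW) ++ replicate (m ∸ n) N))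
    where
    zigzag≡ : zigzag (suc m) (suc n) (toℕ (inject₁ r)) ≡
              sW^ (toℕ r) ++ tW ++ concat (replicate (n ∸ toℕ r) tW) ++ replicate (m ∸ n) N
    zigzag≡ rewrite toℕ-inject₁ r | ℕ.+-∸-assoc 1 (toℕ≤pred[n] r) = refl

  laurent : ∀ {n} → PM → ℕ → (F : Fin n → Poly) → (∀ r → Nonneg (F r)) → Fin n → SignedLaurent
  laurent σ K F F≥0 r = record { sign = alternating σ (toℕ r) ; poly = F r ; shift = K ; nonneg = F≥0 r }

  zigzagCombination : (m n : ℕ) → (Fin (suc n) → SignedLaurent) → Combination
  zigzagCombination m n c = tabulate λ r → ratFun (c r) , zigzag m n (toℕ r)

  -- The induction hypothesis: coefficients σ (−1)^r q^(−K) F r with a common power of q.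
  record Expansion (m n : ℕ) (w : Word) : Set where
    field
      σ   : PM
      K   : ℕ
      F   : Fin (suc n) → Poly
      F≥0 : ∀ r → Nonneg (F r)
      w∼  : (1# , w) ∷ [] ∼ zigzagCombination m n (laurent σ K F F≥0)

  expansion-N^ : ∀ m → Expansion m 0 (replicate m N)
  expansion-N^ m = record
    { σ = plus ; K = 0 ; F = λ _ → 1ₚ ; F≥0 = λ _ → ℤ.+≤+ z≤n ∷ [] ; w∼ = ∼-single (replicate m N) ≃-refl }

  pair·expansion : ∀ a b {X Z} → (1# , X) ∷ [] ∼ Z → ⟨ a , b ⟩· X ∼ scale a (prefix sW Z) ++ scale b (prefix tW Z)
  pair·expansion a b {X} X∼Z =
    ∼-trans (∼-++ (∼-single (sW ++ X) (x≃x*1 a)) (∼-single (tW ++ X) (x≃x*1 b)))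
            (∼-++ (∼-scale a (∼-prefix sW X∼Z)) (∼-scale b (∼-prefix tW X∼Z)))
    where x≃x*1 : ∀ x → x ≃ x * 1#
          x≃x*1 = solve-∀ almostCommutativeRing

  module Step {m n} (pre : Word) (P : Pair) (post : Word) (expansion : Expansion m n (pre ++ post)) where

    open Expansion expansion
    k : ℤ
    k = height (initialHeight P) pre
    open SignedPair (αβ-signed k)

    γ : Fin (suc n) → RatFun
    γ r = ratFun (laurent σ K F F≥0 r)

    Fˡ Fʳ F' : Fin (suc (suc n)) → Poly
    Fˡ = insertAt F fz []
    Fʳ = insertAt F (fromℕ (suc n)) []
    F' r = (A *ₚ Fˡ r) +ₚ (B *ₚ Fʳ r)

    F'≥0 : ∀ r → Nonneg (F' r)
    F'≥0 r = nonneg-+ (nonneg-* A≥0 (insertAt-preserves Nonneg F≥0 [] fz r))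
                      (nonneg-* B≥0 (insertAt-preserves Nonneg F≥0 [] (fromℕ (suc n)) r))

    σ' : PM
    σ' = flip (ε · σ)

    K' : ℕ
    K' = e ℕ.+ K

    γˡ≃ : ∀ r → insertAt γ fz 0# r ≃ - ± (alternating σ (toℕ r)) * ⟦ Fˡ r ⟧ * q⁻¹^ K
    γˡ≃ fz     = zero≃ (- ± σ) (q⁻¹^ K)
      where zero≃ : ∀ s Q → 0# ≃ s * 0# * Q
            zero≃ = solve-∀ almostCommutativeRing
    γˡ≃ (fs r) = ≃-trans (ratFun≃ (laurent σ K F F≥0 r))
      (*-cong (*-cong (≃-sym (≃-trans (-‿cong (±-flip s)) (double-negation (± s)))) (≃-refl {⟦ F r ⟧})) (≃-refl {q⁻¹^ K}))
      where
      s : PM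
      s = alternating σ (toℕ r)
      double-negation : ∀ x → - - x ≃ x
      double-negation = solve-∀ almostCommutativeRing

    γʳ≃ : ∀ r → insertAt γ (fromℕ (suc n)) 0# r ≃ ± (alternating σ (toℕ r)) * ⟦ Fʳ r ⟧ * q⁻¹^ K
    γʳ≃ = insertAt-last-pointwise (λ i a p → a ≃ ± (alternating σ i) * ⟦ p ⟧ * q⁻¹^ K)
            (λ r → ratFun≃ (laurent σ K F F≥0 r)) (zero≃ (± (alternating σ (suc n))) (q⁻¹^ K))
      where zero≃ : ∀ s Q → 0# ≃ s * 0# * Q
            zero≃ = solve-∀ almostCommutativeRing

    ±σ' : ∀ r → ± (alternating σ' r) ≃ - (± ε * ± (alternating σ r))
    ±σ' r rewrite alternating-flip (ε · σ) r | alternating-· ε σ r =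
      ≃-trans (±-flip (ε · alternating σ r)) (-‿cong (±-· ε (alternating σ r)))

    γ'≃ : ∀ r → ratFun (laurent σ' K' F' F'≥0 r) ≃ α k * insertAt γ fz 0# r + β k * insertAt γ (fromℕ (suc n)) 0# r
    γ'≃ r = begin
      ratFun (laurent σ' K' F' F'≥0 r)
        ≈⟨ ratFun≃ (laurent σ' K' F' F'≥0 r) ⟩
      ± (alternating σ' (toℕ r)) * ⟦ F' r ⟧ * q⁻¹^ K'
        ≈⟨ *-cong (*-cong (±σ' (toℕ r)) (≃-trans (⟦⟧-+ (A *ₚ Fˡ r) (B *ₚ Fʳ r)) (+-cong (⟦⟧-* A (Fˡ r)) (⟦⟧-* B (Fʳ r)))))
                  (q⁻¹^-+ e K) ⟩
      - (± ε * t) * (⟦ A ⟧ * ⟦ Fˡ r ⟧ + ⟦ B ⟧ * ⟦ Fʳ r ⟧) * (q⁻¹^ e * q⁻¹^ K)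
        ≈⟨ identity (± ε) t ⟦ A ⟧ ⟦ B ⟧ ⟦ Fˡ r ⟧ ⟦ Fʳ r ⟧ (q⁻¹^ e) (q⁻¹^ K) ⟩
      (± ε * ⟦ A ⟧ * q⁻¹^ e) * (- t * ⟦ Fˡ r ⟧ * q⁻¹^ K) + - (± ε * ⟦ B ⟧ * q⁻¹^ e) * (t * ⟦ Fʳ r ⟧ * q⁻¹^ K)
        ≈⟨ ≃-sym (+-cong (*-cong a≃ (γˡ≃ r)) (*-cong b≃ (γʳ≃ r))) ⟩
      α k * insertAt γ fz 0# r + β k * insertAt γ (fromℕ (suc n)) 0# r ∎
      where
      open ≃-Reasoning
      t : RatFun
      t = ± (alternating σ (toℕ r))
      identity : ∀ ε t A B Fˡ Fʳ Qe QK →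
        - (ε * t) * (A * Fˡ + B * Fʳ) * (Qe * QK) ≃ (ε * A * Qe) * (- t * Fˡ * QK) + - (ε * B * Qe) * (t * Fʳ * QK)
      identity = solve-∀ almostCommutativeRing

    Z : Fin (suc (suc n)) → Word
    Z r = zigzag (suc m) (suc n) (toℕ r)

    t·Z : ∀ c (r : Fin (suc n)) → (c , tW ++ zigzag m n (toℕ r)) ∷ [] ∼ (c , Z (inject₁ r)) ∷ []
    t·Z c r = ∼-trans (∼-single _ (x≃x*1 c)) (∼-trans (∼-scale c (t·zigzag m n r)) (∼-single _ (≃-sym (x≃x*1 c))))
      where x≃x*1 : ∀ x → x ≃ x * 1#
            x≃x*1 = solve-∀ almostCommutativeRing

    w∼' : (1# , pre ++ pairWord P ++ post) ∷ [] ∼ zigzagCombination (suc m) (suc n) (laurent σ' K' F' F'≥0)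
    w∼' = begin
      (1# , pre ++ pairWord P ++ post) ∷ []
        ≈⟨ move-pair P pre post ⟩
      ⟨ α k , β k ⟩· (pre ++ post)
        ≈⟨ pair·expansion (α k) (β k) w∼ ⟩
      scale (α k) (prefix sW Zₙ) ++ scale (β k) (prefix tW Zₙ)
        ≡⟨ cong₂ _++_ (scale-prefix-tabulate (α k) sW γ W) (scale-prefix-tabulate (β k) tW γ W) ⟩
      tabulate (λ r → α k * γ r , Z (fs r)) ++ tabulate (λ r → β k * γ r , tW ++ W r)
        ≈⟨ ∼-++ (∼-reflexive {tabulate (λ r → α k * γ r , Z (fs r))} refl) (∼-tabulate λ r → t·Z (β k * γ r) r) ⟩
      tabulate (λ r → α k * γ r , Z (fs r)) ++ tabulate (λ r → β k * γ r , Z (inject₁ r))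
        ≈⟨ convolution (α k) (β k) γ (λ r → ratFun (laurent σ' K' F' F'≥0 r)) Z γ'≃ ⟩
      zigzagCombination (suc m) (suc n) (laurent σ' K' F' F'≥0) ∎
      where
      open ∼-Reasoning
      W : Fin (suc n) → Word
      W r = zigzag m n (toℕ r)
      Zₙ : Combination
      Zₙ = zigzagCombination m n (laurent σ K F F≥0)

  expansion-step : ∀ {m n} pre P post → Expansion m n (pre ++ post) → Expansion (suc m) (suc n) (pre ++ pairWord P ++ post)
  expansion-step pre P post expansion = record { σ = σ' ; K = K' ; F = F' ; F≥0 = F'≥0 ; w∼ = w∼' }
    where open Step pre P post expansion

module Words where

  open Straightening using (Pair; en; ne; pairWord)

  count-++ : ∀ l u v → count l (u ++ v) ≡ count l u ℕ.+ count l v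
  count-++ l []      v = refl
  count-++ N (N ∷ u) v = cong suc (count-++ N u v)
  count-++ N (E ∷ u) v = count-++ N u v
  count-++ E (N ∷ u) v = count-++ E u v
  count-++ E (E ∷ u) v = cong suc (count-++ E u v)

  count-pairWord : ∀ l P v → count l (pairWord P ++ v) ≡ suc (count l v)
  count-pairWord N en v = refl
  count-pairWord N ne v = refl
  count-pairWord E en v = refl
  count-pairWord E ne v = refl

  count-insert-pair : ∀ l pre P post → count l (pre ++ pairWord P ++ post) ≡ suc (count l (pre ++ post))
  count-insert-pair l pre P post = begin
    count l (pre ++ pairWord P ++ post)           ≡⟨ count-++ l pre (pairWord P ++ post) ⟩
    count l pre ℕ.+ count l (pairWord P ++ post)  ≡⟨ cong (count l pre ℕ.+_) (count-pairWord l P post) ⟩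
    count l pre ℕ.+ suc (count l post)            ≡⟨ ℕ.+-suc (count l pre) (count l post) ⟩
    suc (count l pre ℕ.+ count l post)            ≡⟨ cong suc (sym (count-++ l pre post)) ⟩
    suc (count l (pre ++ post))                   ∎
    where open ≡-Reasoning

  adjacent-pair : ∀ w → 0 < count E w → 0 < count N w → ∃ λ pre → ∃ λ P → ∃ λ post → w ≡ pre ++ pairWord P ++ post
  adjacent-pair (N ∷ E ∷ w) _ _ = [] , ne , w , refl
  adjacent-pair (E ∷ N ∷ w) _ _ = [] , en , w , refl
  adjacent-pair (N ∷ N ∷ w) E∈w _ with adjacent-pair (N ∷ w) E∈w (s≤s z≤n)
  ... | pre , P , post , w≡ = N ∷ pre , P , post , cong (N ∷_) w≡
  adjacent-pair (E ∷ E ∷ w) _ N∈w with adjacent-pair (E ∷ w) (s≤s z≤n) N∈w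
  ... | pre , P , post , w≡ = E ∷ pre , P , post , cong (E ∷_) w≡

  count-E≡0 : ∀ w → count E w ≡ 0 → w ≡ replicate (count N w) N
  count-E≡0 []      _ = refl
  count-E≡0 (N ∷ w) h = cong (N ∷_) (count-E≡0 w h)


open LinearCombinations using (⌊_⌋; ∼⇒EqP)
open SignedLaurentPolynomials using (ratFun)
open ZigzagExpansions
open Words

expansion : ∀ m n w → n ≤ m → count N w ≡ m → count E w ≡ n → Expansion m n w
expansion m zero w _ refl #E≡0 = subst (Expansion (count N w) 0) (sym (count-E≡0 w #E≡0)) (expansion-N^ (count N w))
expansion (suc m) (suc n) w (s≤s n≤m) #N #E
  with adjacent-pair w (subst (0 <_) (sym #E) (s≤s z≤n)) (subst (0 <_) (sym #N) (s≤s z≤n))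
... | pre , P , post , refl = expansion-step pre P post
  (expansion m n (pre ++ post) n≤m (ℕ.suc-injective (trans (sym (count-insert-pair N pre P post)) #N))
                                   (ℕ.suc-injective (trans (sym (count-insert-pair E pre P post)) #E)))

theorem3p14 : (m n : ℕ) → n ≤ m → (w : Word) → count N w ≡ m → count E w ≡ n →
  ∃ λ (c : Fin (suc n) → SignedLaurent) → EqP ((1F , w) ∷ []) (zigzagSum m n c)
theorem3p14 m n n≤m w #N #E = c , subst (EqP ((1F , w) ∷ [])) ⌊zigzagCombination⌋ (∼⇒EqP w∼)
  where
  open Expansion (expansion m n w n≤m #N #E)
  c : Fin (suc n) → SignedLaurent
  c = laurent σ K F F≥0
  ⌊zigzagCombination⌋ : ⌊ zigzagCombination m n c ⌋ ≡ zigzagSum m n c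
  ⌊zigzagCombination⌋ = map-tabulate (λ r → ratFun (c r) , zigzag m n (toℕ r)) _
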